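{- For every integer $r\ge1$ and every $n\ge0$, $$L_n(\boldsymbol{e}(x_1,\dots,x_r),y)=(\tilde{\mathcal D}_r+y)^n\,1,$$ where $\tilde{\mathcal D}_r=\mathcal D_r+\big(\sum_{i=1}^r x_i\big)\,y\frac{\partial}{\partial y}$ and $\mathcal D_r=\sum_{i=1}^r\Big(x_i\sum_{1\le j\le r,\,j\ne i}x_j\Big)\frac{\partial}{\partial x_i}$, and $y$ acts by multiplication.
   Context: $x_1,\dots,x_r,y$ are indeterminates; $\boldsymbol{e}(x_1,\dots,x_r)=(e_n(x_1,\dots,x_r))_{n\ge0}$ are the elementary symmetric polynomials ($e_0=1$, $e_n=0$ for $n>r$). Generic Lah polynomials: an ordered tree is a rooted tree with linearly ordered children at each vertex; an increasing ordered tree on a set of integers is one bijectively labeled by that set with children having larger labels than parents. For $\boldsymbol{\phi}=(\phi_i)_{i\ge0}$, $L_{n,k}(\boldsymbol{\phi})$ is the sum over unordered forests of $k$ increasing ordered trees whose vertex sets partition $[n]$ of $\prod_v\phi_{\deg(v)}$ ($\deg(v)$ = number of children; $L_{0,0}=1$), and $L_n(\boldsymbol{\phi},y)=\sum_{k=0}^nL_{n,k}(\boldsymbol{\phi})y^k$. -}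

module Defs where

open import Data.Nat using (ℕ; zero; suc; _+_; _*_; _<_; _≟_; pred)
open import Data.Bool using (Bool; true; false; if_then_else_)
open import Data.Fin using (Fin)
import Data.Fin as F
open import Data.List using (List; []; _∷_; _++_; map; concatMap; filter; length; upTo; allFin; foldr)
open import Data.List.Relation.Unary.All using (All)
open import Data.List.Relation.Unary.Linked using (Linked)
open import Data.List.Relation.Binary.Permutation.Propositional using (_↭_)
open import Data.Vec using (Vec; replicate; lookup; _[_]%=_; zipWith)
import Data.Vec as V
import Data.Vec.Properties as VP
import Data.Product.Properties as PP
open import Data.Product using (_×_; _,_)
open import Data.Unit using (⊤)
open import Relation.Nullary using (¬?; does)
open import Relation.Binary.PropositionalEquality using (_≡_)

-- Polynomials in ℕ[x₁,…,x_r, y], represented as formal sums of terms.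
-- A monomial is (exponent vector of x₁..x_r , exponent of y).
-- Two polynomials are equal iff all their coefficients agree.

Mon : ℕ → Set
Mon r = Vec ℕ r × ℕ

Term : ℕ → Set
Term r = ℕ × Mon r

Poly : ℕ → Set
Poly r = List (Term r)

_≟M_ : ∀ {r} → (m m′ : Mon r) → _
_≟M_ = PP.≡-dec (VP.≡-dec _≟_) _≟_

coeff : ∀ {r} → Poly r → Mon r → ℕ
coeff [] m = 0
coeff ((c , m′) ∷ p) m = (if does (m′ ≟M m) then c else 0) + coeff p m

_≈P_ : ∀ {r} → Poly r → Poly r → Set
p ≈P q = ∀ m → coeff p m ≡ coeff q m

zeroP : ∀ {r} → Poly r
zeroP = []

oneP : ∀ {r} → Poly r
oneP {r} = (1 , (replicate r 0 , 0)) ∷ []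

_+P_ : ∀ {r} → Poly r → Poly r → Poly r
_+P_ = _++_

monMul : ∀ {r} → Mon r → Mon r → Mon r
monMul (a , b) (a′ , b′) = (zipWith _+_ a a′ , b + b′)

_*P_ : ∀ {r} → Poly r → Poly r → Poly r
p *P q = concatMap (λ { (c , m) → map (λ { (c′ , m′) → (c * c′ , monMul m m′) }) q }) p

xVar : ∀ {r} → Fin r → Poly r
xVar {r} i = (1 , ((replicate r 0 [ i ]%= suc) , 0)) ∷ []

yVar : ∀ {r} → Poly r
yVar {r} = (1 , (replicate r 0 , 1)) ∷ []

yPow : ∀ {r} → ℕ → Poly r
yPow {r} k = (1 , (replicate r 0 , k)) ∷ []

sumP : ∀ {r} → List (Poly r) → Poly r
sumP = foldr _+P_ zeroP

∂x : ∀ {r} → Fin r → Poly r → Poly r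
∂x i = map (λ { (c , (a , b)) → (c * lookup a i , ((a [ i ]%= pred) , b)) })

∂y : ∀ {r} → Poly r → Poly r
∂y = map (λ { (c , (a , b)) → (c * b , (a , pred b)) })

allSubsets : (r : ℕ) → List (Vec Bool r)
allSubsets zero = V.[] ∷ []
allSubsets (suc r) = map (true V.∷_) (allSubsets r) ++ map (false V.∷_) (allSubsets r)

card : ∀ {r} → Vec Bool r → ℕ
card = V.foldr _ (λ b n → (if b then 1 else 0) + n) 0

subsetMon : ∀ {r} → Vec Bool r → Mon r
subsetMon S = (V.map (λ b → if b then 1 else 0) S , 0)

esym : (r : ℕ) → ℕ → Poly r
esym r d = map (λ S → (1 , subsetMon S)) (filter (λ S → card S ≟ d) (allSubsets r))

data Tree : Set where
  node : ℕ → List Tree → Tree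

rootLabel : Tree → ℕ
rootLabel (node l _) = l

mutual
  labelsT : Tree → List ℕ
  labelsT (node l ts) = l ∷ labelsF ts

  labelsF : List Tree → List ℕ
  labelsF [] = []
  labelsF (t ∷ ts) = labelsT t ++ labelsF ts

mutual
  IncT : Tree → Set
  IncT (node l ts) = All (λ t → l < rootLabel t) ts × IncF ts

  IncF : List Tree → Set
  IncF [] = ⊤
  IncF (t ∷ ts) = IncT t × IncF ts

-- An unordered forest is represented canonically as the list of its
-- trees sorted by strictly increasing root label.
-- A forest of increasing ordered trees on [n] = {1,…,n}:
IncForestOn : ℕ → List Tree → Set
IncForestOn n F =
  IncF F × Linked _<_ (map rootLabel F) × (labelsF F ↭ map suc (upTo n))

mutual
  wT : ∀ {r} → (ℕ → Poly r) → Tree → Poly r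
  wT φ (node l ts) = φ (length ts) *P wF φ ts

  wF : ∀ {r} → (ℕ → Poly r) → List Tree → Poly r
  wF φ [] = oneP
  wF φ (t ∷ ts) = wT φ t *P wF φ ts

-- contribution of a forest with k trees to L_n(φ,y): (∏_v φ_{deg v}) y^k
forestWeight : ∀ {r} → (ℕ → Poly r) → List Tree → Poly r
forestWeight φ F = wF φ F *P yPow (length F)

-- L_n(φ,y) computed as a sum over a given list of forests; the statement
-- quantifies over every duplicate-free list enumerating exactly the
-- forests of increasing ordered trees on [n].
lahSum : ∀ {r} → (ℕ → Poly r) → List (List Tree) → Poly r
lahSum φ enum = sumP (map (forestWeight φ) enum)

Dr : ∀ {r} → Poly r → Poly r
Dr {r} p = sumP (map (λ i →
  (xVar i *P sumP (map xVar (filter (λ j → ¬? (j F.≟ i)) (allFin r)))) *P ∂x i p)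
  (allFin r))

Dtilde : ∀ {r} → Poly r → Poly r
Dtilde {r} p = Dr p +P ((sumP (map xVar (allFin r)) *P yVar) *P ∂y p)

step : ∀ {r} → Poly r → Poly r
step p = Dtilde p +P (yVar *P p)

rhs : (r n : ℕ) → Poly r
rhs r zero = oneP
rhs r (suc n) = step (rhs r n)

module Submission where

-- Every increasing forest on [n+1] arises in exactly one way from an increasing
-- forest on [n] by inserting the largest label n+1 as a leaf: either as a new
-- one-vertex tree (placed last, as roots are listed increasingly) or as a child
-- of some vertex v, in one of the deg(v)+1 gaps between its children.  For the
-- weight (∏_v e_{deg v}) y^k, inserting below v replaces e_d by (d+1) e_{d+1}
-- in d+1 ways, and the identity  D_r e_d + e₁ e_d = d e₁ e_d + (d+1) e_{d+1}
-- (e₁ = Σ x_i) shows that summing over all v is exactly D_r + k e₁, i.e. the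
-- operator D̃_r = D_r + e₁ y ∂/∂y on w·y^k; the new one-vertex tree is the
-- multiplication by y.
--
-- The
-- theorem follows because any duplicate-free enumeration of the forests is a
-- permutation of the generated one.

open import Defs
open import Level using (0ℓ)
open import Function using (_∘_)
open import Function.Bundles using (mk⇔)
open import Algebra using (CommutativeSemiring)
open import Relation.Binary.PropositionalEquality
open import Relation.Nullary using (Dec; yes; no; does; ¬_; ¬?)
open import Relation.Nullary.Decidable using (dec-true; dec-false)
open import Data.Empty using (⊥-elim)
open import Data.Unit using (tt)
open import Data.Bool using (Bool; true; false; if_then_else_)
open import Data.Product using (Σ; ∃; _×_; _,_; proj₁; proj₂)
open import Data.Sum using (inj₁; inj₂)
open import Data.Nat using (ℕ; zero; suc; _+_; _*_; pred; _≟_; _<_; _≤_; _≤?_; _∸_; s≤s)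
open import Data.Nat.Properties
open import Data.Nat.ListAction using (sum)
open import Data.Nat.ListAction.Properties using (sum-↭)
open import Data.Fin using (Fin)
import Data.Fin as 𝔽
open import Data.Vec using (Vec; zipWith; replicate; lookup; _[_]%=_)
import Data.Vec as V
import Data.Vec.Properties as VP
open import Data.List using (List; []; _∷_; _++_; map; concatMap; filter; length; allFin; upTo)
import Data.List.Properties as LP
open import Data.List.Relation.Unary.All using (All; []; _∷_)
import Data.List.Relation.Unary.All as All
import Data.List.Relation.Unary.All.Properties as AllP
open import Data.List.Relation.Unary.Any using (here; there)
open import Data.List.Relation.Unary.AllPairs using ([]; _∷_)
open import Data.List.Relation.Unary.Linked using (Linked; []; [-]; _∷_)
import Data.List.Relation.Unary.Linked as Linked
open import Data.List.Relation.Unary.Unique.Propositional using (Unique)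
import Data.List.Relation.Unary.Unique.Propositional.Properties as UniqueP
open import Data.List.Membership.Propositional using (_∈_; _∉_; find; lose)
open import Data.List.Membership.Propositional.Properties using (∈-map⁺; ∈-map⁻; ∈-++⁺ˡ; ∈-++⁺ʳ; ∈-++⁻; ∈-upTo⁻; ∈-concatMap⁻; ∈-concatMap⁺)
open import Data.List.Membership.Propositional.Properties.WithK using (unique∧set⇒bag)
open import Data.List.Relation.Binary.Disjoint.Propositional using (Disjoint)
open import Data.List.Relation.Binary.Permutation.Propositional using (_↭_; ↭-refl; ↭-sym; ↭-trans; ↭-prep; ↭-swap)
import Data.List.Relation.Binary.Permutation.Propositional.Properties as PermP
open import Data.List.Relation.Binary.BagAndSetEquality using (∼bag⇒↭)

-- Finite sums of natural numbers.  All identities between polynomials are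
-- reduced to identities between such sums of coefficients.

private variable
  A B : Set

∑ : (A → ℕ) → List A → ℕ
∑ f [] = 0
∑ f (x ∷ xs) = f x + ∑ f xs

∑-++ : (f : A → ℕ) (xs ys : List A) → ∑ f (xs ++ ys) ≡ ∑ f xs + ∑ f ys
∑-++ f [] ys = refl
∑-++ f (x ∷ xs) ys = trans (cong (f x +_) (∑-++ f xs ys)) (sym (+-assoc (f x) _ _))

∑-cong : {f g : A → ℕ} (xs : List A) → (∀ x → f x ≡ g x) → ∑ f xs ≡ ∑ g xs
∑-cong [] e = refl
∑-cong (x ∷ xs) e = cong₂ _+_ (e x) (∑-cong xs e)

∑-+ : (f g : A → ℕ) (xs : List A) → ∑ (λ x → f x + g x) xs ≡ ∑ f xs + ∑ g xs
∑-+ f g [] = refl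
∑-+ f g (x ∷ xs) =
  trans (cong (f x + g x +_) (∑-+ f g xs)) (interchange (f x) (g x) (∑ f xs) (∑ g xs))
  where open import Algebra.Properties.CommutativeSemigroup +-commutativeSemigroup using (interchange)

∑-*ˡ : (c : ℕ) (f : A → ℕ) (xs : List A) → c * ∑ f xs ≡ ∑ (λ x → c * f x) xs
∑-*ˡ c f [] = *-zeroʳ c
∑-*ˡ c f (x ∷ xs) = trans (*-distribˡ-+ c (f x) (∑ f xs)) (cong (c * f x +_) (∑-*ˡ c f xs))

∑-zero : (xs : List A) → ∑ (λ _ → 0) xs ≡ 0
∑-zero [] = refl
∑-zero (x ∷ xs) = ∑-zero xs

∑-swap : (f : A → B → ℕ) (xs : List A) (ys : List B) →
  ∑ (λ x → ∑ (f x) ys) xs ≡ ∑ (λ y → ∑ (λ x → f x y) xs) ys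
∑-swap f [] ys = sym (∑-zero ys)
∑-swap f (x ∷ xs) ys =
  trans (cong (∑ (f x) ys +_) (∑-swap f xs ys)) (sym (∑-+ (f x) (λ y → ∑ (λ x → f x y) xs) ys))

∑-map : (f : B → ℕ) (g : A → B) (xs : List A) → ∑ f (map g xs) ≡ ∑ (f ∘ g) xs
∑-map f g [] = refl
∑-map f g (x ∷ xs) = cong (f (g x) +_) (∑-map f g xs)

∑-concatMap : (f : B → ℕ) (g : A → List B) (xs : List A) →
  ∑ f (concatMap g xs) ≡ ∑ (λ x → ∑ f (g x)) xs
∑-concatMap f g [] = refl
∑-concatMap f g (x ∷ xs) =
  trans (∑-++ f (g x) (concatMap g xs)) (cong (∑ f (g x) +_) (∑-concatMap f g xs))

∑-↭ : (f : A → ℕ) {xs ys : List A} → xs ↭ ys → ∑ f xs ≡ ∑ f ys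
∑-↭ f {xs} {ys} p = trans (∑≡sum xs) (trans (sum-↭ (PermP.map⁺ f p)) (sym (∑≡sum ys)))
  where
  ∑≡sum : ∀ zs → ∑ f zs ≡ sum (map f zs)
  ∑≡sum [] = refl
  ∑≡sum (z ∷ zs) = cong (f z +_) (∑≡sum zs)

iverson : {P : Set} → Dec P → ℕ → ℕ
iverson d c = if does d then c else 0

iverson-yes : {P : Set} (d : Dec P) (c : ℕ) → P → iverson d c ≡ c
iverson-yes (yes _) c _ = refl
iverson-yes (no ¬p) c p = ⊥-elim (¬p p)

iverson-no : {P : Set} (d : Dec P) (c : ℕ) → ¬ P → iverson d c ≡ 0
iverson-no (yes p) c ¬p = ⊥-elim (¬p p)
iverson-no (no _) c ¬p = refl

iverson-⇔ : {P Q : Set} (d : Dec P) (d′ : Dec Q) (c : ℕ) → (P → Q) → (Q → P) → iverson d c ≡ iverson d′ c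
iverson-⇔ (yes p) d′ c f g = sym (iverson-yes d′ c (f p))
iverson-⇔ (no ¬p) d′ c f g = sym (iverson-no d′ c (¬p ∘ g))

iverson-*ʳ : {P : Set} (d : Dec P) (a c : ℕ) → a * iverson d c ≡ iverson d (a * c)
iverson-*ʳ (yes _) a c = refl
iverson-*ʳ (no _) a c = *-zeroʳ a

iverson-zero : {P : Set} (d : Dec P) → iverson d 0 ≡ 0
iverson-zero (yes _) = refl
iverson-zero (no _) = refl

iverson-+ : {P : Set} (d : Dec P) (a c : ℕ) → iverson d (a + c) ≡ iverson d a + iverson d c
iverson-+ (yes _) a c = refl
iverson-+ (no _) a c = refl

iverson-¬ : {P : Set} (d : Dec P) (c : ℕ) → iverson (¬? d) c + iverson d c ≡ c
iverson-¬ (yes _) c = refl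
iverson-¬ (no _) c = +-identityʳ c

∑-filter : {P : A → Set} (P? : ∀ x → Dec (P x)) (f : A → ℕ) (xs : List A) →
  ∑ f (filter P? xs) ≡ ∑ (λ x → iverson (P? x) (f x)) xs
∑-filter P? f [] = refl
∑-filter P? f (x ∷ xs) with does (P? x)
... | true = cong (f x +_) (∑-filter P? f xs)
... | false = ∑-filter P? f xs

allFin-suc : ∀ n → allFin (suc n) ≡ 𝔽.zero ∷ map 𝔽.suc (allFin n)
allFin-suc n = cong (𝔽.zero ∷_) (sym (LP.map-tabulate (λ i → i) 𝔽.suc))

∑-allFin-suc : ∀ {n} (f : Fin (suc n) → ℕ) → ∑ f (allFin (suc n)) ≡ f 𝔽.zero + ∑ (f ∘ 𝔽.suc) (allFin n)
∑-allFin-suc {n} f = trans (cong (∑ f) (allFin-suc n)) (cong (f 𝔽.zero +_) (∑-map f 𝔽.suc (allFin n)))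

∑-delta : ∀ {n} (f : Fin n → ℕ) (i : Fin n) → ∑ (λ j → iverson (j 𝔽.≟ i) (f j)) (allFin n) ≡ f i
∑-delta {suc n} f 𝔽.zero = trans (∑-allFin-suc (λ j → iverson (j 𝔽.≟ 𝔽.zero) (f j)))
  (trans (cong (f 𝔽.zero +_) (∑-zero (allFin n))) (+-identityʳ _))
∑-delta {suc n} f (𝔽.suc i) = trans (∑-allFin-suc (λ j → iverson (j 𝔽.≟ 𝔽.suc i) (f j))) (∑-delta (f ∘ 𝔽.suc) i)

others : ∀ {n} → Fin n → List (Fin n)
others {n} i = filter (λ j → ¬? (j 𝔽.≟ i)) (allFin n)

∑-others : ∀ {n} (f : Fin n → ℕ) (i : Fin n) → ∑ f (others i) + f i ≡ ∑ f (allFin n)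
∑-others {n} f i = begin
  ∑ f (others i) + f i
    ≡⟨ cong₂ _+_ (∑-filter (λ j → ¬? (j 𝔽.≟ i)) f (allFin n)) (sym (∑-delta f i)) ⟩
  ∑ (λ j → iverson (¬? (j 𝔽.≟ i)) (f j)) (allFin n) + ∑ (λ j → iverson (j 𝔽.≟ i) (f j)) (allFin n)
    ≡⟨ sym (∑-+ _ _ (allFin n)) ⟩
  ∑ (λ j → iverson (¬? (j 𝔽.≟ i)) (f j) + iverson (j 𝔽.≟ i) (f j)) (allFin n)
    ≡⟨ ∑-cong (allFin n) (λ j → iverson-¬ (j 𝔽.≟ i) (f j)) ⟩
  ∑ f (allFin n) ∎
  where open ≡-Reasoning

termCoeff : ∀ {r} → Term r → Mon r → ℕ
termCoeff (c , u) m = iverson (u ≟M m) c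

coeff-∑ : ∀ {r} (p : Poly r) m → coeff p m ≡ ∑ (λ s → termCoeff s m) p
coeff-∑ [] m = refl
coeff-∑ (s ∷ p) m = cong (termCoeff s m +_) (coeff-∑ p m)

coeff-+ : ∀ {r} (p q : Poly r) m → coeff (p +P q) m ≡ coeff p m + coeff q m
coeff-+ p q m = trans (coeff-∑ (p ++ q) m)
  (trans (∑-++ _ p q) (sym (cong₂ _+_ (coeff-∑ p m) (coeff-∑ q m))))

termCoeff-zero : ∀ {r} (u m : Mon r) → termCoeff (0 , u) m ≡ 0
termCoeff-zero u m = iverson-zero (u ≟M m)

termCoeff-+ : ∀ {r} (x y : ℕ) (u m : Mon r) → termCoeff (x + y , u) m ≡ termCoeff (x , u) m + termCoeff (y , u) m
termCoeff-+ x y u m = iverson-+ (u ≟M m) x y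

-- _≈P_ wrapped in a record: _≈P_ unfolds to a Π-type, from which Agda cannot
-- recover the two polynomials, whereas it can from this record type.
infix 4 _≋_
record _≋_ {r} (p q : Poly r) : Set where
  constructor mk
  field un : p ≈P q
open _≋_ public

≋-refl : ∀ {r} {p : Poly r} → p ≋ p
≋-refl = mk λ m → refl

≋-sym : ∀ {r} {p q : Poly r} → p ≋ q → q ≋ p
≋-sym e = mk λ m → sym (un e m)

≋-trans : ∀ {r} {p q s : Poly r} → p ≋ q → q ≋ s → p ≋ s
≋-trans e f = mk λ m → trans (un e m) (un f m)

≡⇒≋ : ∀ {r} {p q : Poly r} → p ≡ q → p ≋ q
≡⇒≋ refl = ≋-refl

infixr 2 _≋⟨_⟩_
infix 3 _∎P

_≋⟨_⟩_ : ∀ {r} (p : Poly r) {q s : Poly r} → p ≋ q → q ≋ s → p ≋ s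
_ ≋⟨ e ⟩ f = ≋-trans e f

_∎P : ∀ {r} (p : Poly r) → p ≋ p
_ ∎P = ≋-refl

single-≡ : ∀ {r} {c c′ : ℕ} {u u′ : Mon r} → c ≡ c′ → u ≡ u′ → ((c , u) ∷ []) ≋ ((c′ , u′) ∷ [])
single-≡ refl refl = ≋-refl

single-zero : ∀ {r} (u : Mon r) → ((0 , u) ∷ []) ≋ zeroP
single-zero u = mk λ m → trans (+-identityʳ _) (termCoeff-zero u m)

+P-cong : ∀ {r} {p p′ q q′ : Poly r} → p ≋ p′ → q ≋ q′ → (p +P q) ≋ (p′ +P q′)
+P-cong {p = p} {p′} {q} {q′} e f = mk λ m →
  trans (coeff-+ p q m) (trans (cong₂ _+_ (un e m) (un f m)) (sym (coeff-+ p′ q′ m)))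

+P-congʳ : ∀ {r} (p : Poly r) {q q′ : Poly r} → q ≋ q′ → (p +P q) ≋ (p +P q′)
+P-congʳ p e = +P-cong (≋-refl {p = p}) e

+P-congˡ : ∀ {r} {p p′ : Poly r} (q : Poly r) → p ≋ p′ → (p +P q) ≋ (p′ +P q)
+P-congˡ q e = +P-cong e (≋-refl {p = q})

+P-comm : ∀ {r} (p q : Poly r) → (p +P q) ≋ (q +P p)
+P-comm p q = mk λ m → trans (coeff-+ p q m) (trans (+-comm (coeff p m) (coeff q m)) (sym (coeff-+ q p m)))

+P-assoc : ∀ {r} (p q s : Poly r) → ((p +P q) +P s) ≋ (p +P (q +P s))
+P-assoc p q s = ≡⇒≋ (LP.++-assoc p q s)

+P-identityˡ : ∀ {r} (p : Poly r) → (zeroP +P p) ≋ p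
+P-identityˡ p = ≋-refl

+P-identityʳ : ∀ {r} (p : Poly r) → (p +P zeroP) ≋ p
+P-identityʳ p = ≡⇒≋ (LP.++-identityʳ p)

vadd : ∀ {r} → Vec ℕ r → Vec ℕ r → Vec ℕ r
vadd = zipWith _+_

vadd-comm : ∀ {r} (a b : Vec ℕ r) → vadd a b ≡ vadd b a
vadd-comm = VP.zipWith-comm +-comm

vadd-assoc : ∀ {r} (a b c : Vec ℕ r) → vadd (vadd a b) c ≡ vadd a (vadd b c)
vadd-assoc = VP.zipWith-assoc +-assoc

vadd-identityˡ : ∀ {r} (a : Vec ℕ r) → vadd (replicate r 0) a ≡ a
vadd-identityˡ = VP.zipWith-identityˡ +-identityˡ

vadd-cancelˡ : ∀ {r} (a b c : Vec ℕ r) → vadd a b ≡ vadd a c → b ≡ c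
vadd-cancelˡ V.[] V.[] V.[] e = refl
vadd-cancelˡ (x V.∷ a) (y V.∷ b) (z V.∷ c) e =
  cong₂ V._∷_ (+-cancelˡ-≡ x y z (VP.∷-injectiveˡ e)) (vadd-cancelˡ a b c (VP.∷-injectiveʳ e))

_∣ℕ?_ : (u m : ℕ) → Dec (Σ ℕ λ v → u + v ≡ m)
u ∣ℕ? m with u ≤? m
... | yes u≤m = yes (m ∸ u , m+[n∸m]≡n u≤m)
... | no u≰m = no λ { (v , e) → u≰m (subst (u ≤_) e (m≤m+n u v)) }

_∣V?_ : ∀ {r} (u m : Vec ℕ r) → Dec (Σ (Vec ℕ r) λ v → vadd u v ≡ m)
V.[] ∣V? V.[] = yes (V.[] , refl)
(x V.∷ u) ∣V? (y V.∷ m) with x ∣ℕ? y | u ∣V? m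
... | yes (a , e) | yes (v , f) = yes (a V.∷ v , cong₂ V._∷_ e f)
... | no ¬d | _ = no λ { (a V.∷ v , e) → ¬d (a , VP.∷-injectiveˡ e) }
... | yes _ | no ¬d = no λ { (a V.∷ v , e) → ¬d (v , VP.∷-injectiveʳ e) }

_∣M?_ : ∀ {r} (u m : Mon r) → Dec (Σ (Mon r) λ v → monMul u v ≡ m)
(a , b) ∣M? (a′ , b′) with a ∣V? a′ | b ∣ℕ? b′
... | yes (v , e) | yes (w , f) = yes ((v , w) , cong₂ _,_ e f)
... | no ¬d | _ = no λ { ((v , w) , e) → ¬d (v , cong proj₁ e) }
... | yes _ | no ¬d = no λ { ((v , w) , e) → ¬d (w , cong proj₂ e) }

monMul-cancelˡ : ∀ {r} (u v w : Mon r) → monMul u v ≡ monMul u w → v ≡ w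
monMul-cancelˡ (a , b) (a′ , b′) (a″ , b″) e =
  cong₂ _,_ (vadd-cancelˡ a a′ a″ (cong proj₁ e)) (+-cancelˡ-≡ b b′ b″ (cong proj₂ e))

monMul-comm : ∀ {r} (u v : Mon r) → monMul u v ≡ monMul v u
monMul-comm (a , b) (a′ , b′) = cong₂ _,_ (vadd-comm a a′) (+-comm b b′)

monMul-assoc : ∀ {r} (u v w : Mon r) → monMul (monMul u v) w ≡ monMul u (monMul v w)
monMul-assoc (a , b) (a′ , b′) (a″ , b″) = cong₂ _,_ (vadd-assoc a a′ a″) (+-assoc b b′ b″)

mon1 : ∀ {r} → Mon r
mon1 {r} = (replicate r 0 , 0)

monMul-identityˡ : ∀ {r} (u : Mon r) → monMul mon1 u ≡ u
monMul-identityˡ (a , b) = cong₂ _,_ (vadd-identityˡ a) refl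

termMul : ∀ {r} → Term r → Term r → Term r
termMul (c , u) (c′ , u′) = (c * c′ , monMul u u′)

∑-*P : ∀ {r} (f : Term r → ℕ) (p q : Poly r) →
  ∑ f (p *P q) ≡ ∑ (λ s → ∑ (λ t → f (termMul s t)) q) p
∑-*P f [] q = refl
∑-*P f (s ∷ p) q =
  trans (∑-++ f (map (termMul s) q) (p *P q)) (cong₂ _+_ (∑-map f (termMul s) q) (∑-*P f p q))

coeff-* : ∀ {r} (p q : Poly r) m →
  coeff (p *P q) m ≡ ∑ (λ s → ∑ (λ t → termCoeff (termMul s t) m) q) p
coeff-* p q m = trans (coeff-∑ (p *P q) m) (∑-*P (λ s → termCoeff s m) p q)

*P-comm : ∀ {r} (p q : Poly r) → (p *P q) ≋ (q *P p)
*P-comm p q = mk λ m → begin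
  coeff (p *P q) m ≡⟨ coeff-* p q m ⟩
  ∑ (λ s → ∑ (λ t → termCoeff (termMul s t) m) q) p ≡⟨ ∑-swap (λ s t → termCoeff (termMul s t) m) p q ⟩
  ∑ (λ t → ∑ (λ s → termCoeff (termMul s t) m) p) q
    ≡⟨ ∑-cong q (λ t → ∑-cong p (λ s → cong (λ z → termCoeff z m) (comm s t))) ⟩
  ∑ (λ t → ∑ (λ s → termCoeff (termMul t s) m) p) q ≡⟨ sym (coeff-* q p m) ⟩
  coeff (q *P p) m ∎
  where
  open ≡-Reasoning
  comm : ∀ s t → termMul s t ≡ termMul t s
  comm (c , u) (c′ , u′) = cong₂ _,_ (*-comm c c′) (monMul-comm u u′)

*P-assoc : ∀ {r} (p q w : Poly r) → ((p *P q) *P w) ≋ (p *P (q *P w))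
*P-assoc p q w = mk λ m → begin
  coeff ((p *P q) *P w) m ≡⟨ coeff-* (p *P q) w m ⟩
  ∑ (λ s → ∑ (λ t → termCoeff (termMul s t) m) w) (p *P q) ≡⟨ ∑-*P _ p q ⟩
  ∑ (λ s → ∑ (λ s′ → ∑ (λ t → termCoeff (termMul (termMul s s′) t) m) w) q) p
    ≡⟨ ∑-cong p (λ s → ∑-cong q (λ s′ → ∑-cong w (λ t → cong (λ z → termCoeff z m) (assoc s s′ t)))) ⟩
  ∑ (λ s → ∑ (λ s′ → ∑ (λ t → termCoeff (termMul s (termMul s′ t)) m) w) q) p
    ≡⟨ ∑-cong p (λ s → sym (∑-*P (λ z → termCoeff (termMul s z) m) q w)) ⟩
  ∑ (λ s → ∑ (λ z → termCoeff (termMul s z) m) (q *P w)) p ≡⟨ sym (coeff-* p (q *P w) m) ⟩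
  coeff (p *P (q *P w)) m ∎
  where
  open ≡-Reasoning
  assoc : ∀ s t w → termMul (termMul s t) w ≡ termMul s (termMul t w)
  assoc (c , u) (c′ , u′) (c″ , u″) = cong₂ _,_ (*-assoc c c′ c″) (monMul-assoc u u′ u″)

quotientCoeff : ∀ {r} → Poly r → Mon r → Mon r → ℕ
quotientCoeff q u m with u ∣M? m
... | yes (v , _) = coeff q v
... | no _ = 0

coeff-termMul : ∀ {r} (c : ℕ) (u : Mon r) (q : Poly r) m →
  ∑ (λ t → termCoeff (termMul (c , u) t) m) q ≡ c * quotientCoeff q u m
coeff-termMul c u q m with u ∣M? m
... | yes (v , e) = trans (∑-cong q shifted)
      (trans (sym (∑-*ˡ c (λ t → termCoeff t v) q)) (cong (c *_) (sym (coeff-∑ q v))))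
  where
  shifted : ∀ t → termCoeff (termMul (c , u) t) m ≡ c * termCoeff t v
  shifted (c′ , u′) = trans (iverson-⇔ (monMul u u′ ≟M m) (u′ ≟M v) (c * c′)
                         (λ x → monMul-cancelˡ u u′ v (trans x (sym e)))
                         (λ x → trans (cong (monMul u) x) e))
                       (sym (iverson-*ʳ (u′ ≟M v) c c′))
... | no ¬d = trans (∑-cong q missed) (trans (∑-zero q) (sym (*-zeroʳ c)))
  where
  missed : ∀ t → termCoeff (termMul (c , u) t) m ≡ 0
  missed (c′ , u′) = iverson-no (monMul u u′ ≟M m) (c * c′) (λ x → ¬d (u′ , x))

quotientCoeff-cong : ∀ {r} {q q′ : Poly r} → q ≈P q′ → ∀ u m → quotientCoeff q u m ≡ quotientCoeff q′ u m
quotientCoeff-cong e u m with u ∣M? m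
... | yes (v , _) = e v
... | no _ = refl

*P-congʳ : ∀ {r} (p : Poly r) {q q′ : Poly r} → q ≋ q′ → (p *P q) ≋ (p *P q′)
*P-congʳ p {q} {q′} e = mk λ m → begin
  coeff (p *P q) m ≡⟨ coeff-* p q m ⟩
  ∑ (λ s → ∑ (λ t → termCoeff (termMul s t) m) q) p ≡⟨ ∑-cong p (λ { (c , u) → sameQuotient c u m }) ⟩
  ∑ (λ s → ∑ (λ t → termCoeff (termMul s t) m) q′) p ≡⟨ sym (coeff-* p q′ m) ⟩
  coeff (p *P q′) m ∎
  where
  open ≡-Reasoning
  sameQuotient : ∀ c u m → ∑ (λ t → termCoeff (termMul (c , u) t) m) q ≡ ∑ (λ t → termCoeff (termMul (c , u) t) m) q′
  sameQuotient c u m = trans (coeff-termMul c u q m)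
    (trans (cong (c *_) (quotientCoeff-cong (un e) u m)) (sym (coeff-termMul c u q′ m)))

*P-congˡ : ∀ {r} {p p′ : Poly r} (q : Poly r) → p ≋ p′ → (p *P q) ≋ (p′ *P q)
*P-congˡ {p = p} {p′} q e =
  (p *P q) ≋⟨ *P-comm p q ⟩ (q *P p) ≋⟨ *P-congʳ q e ⟩ (q *P p′) ≋⟨ *P-comm q p′ ⟩ (p′ *P q) ∎P

*P-cong : ∀ {r} {p p′ q q′ : Poly r} → p ≋ p′ → q ≋ q′ → (p *P q) ≋ (p′ *P q′)
*P-cong {p′ = p′} {q = q} e f = ≋-trans (*P-congˡ q e) (*P-congʳ p′ f)

*P-distribʳ : ∀ {r} (p q w : Poly r) → ((p +P q) *P w) ≋ ((p *P w) +P (q *P w))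
*P-distribʳ p q w = ≡⇒≋ (*P-++ p q)
  where
  *P-++ : ∀ p q → (p ++ q) *P w ≡ (p *P w) ++ (q *P w)
  *P-++ [] q = refl
  *P-++ (s ∷ p) q = trans (cong (_++_ _) (*P-++ p q)) (sym (LP.++-assoc _ (p *P w) (q *P w)))

*P-distribˡ : ∀ {r} (w p q : Poly r) → (w *P (p +P q)) ≋ ((w *P p) +P (w *P q))
*P-distribˡ w p q =
  (w *P (p +P q)) ≋⟨ *P-comm w (p +P q) ⟩
  ((p +P q) *P w) ≋⟨ *P-distribʳ p q w ⟩
  ((p *P w) +P (q *P w)) ≋⟨ +P-cong (*P-comm p w) (*P-comm q w) ⟩
  ((w *P p) +P (w *P q)) ∎P

*P-zeroˡ : ∀ {r} (p : Poly r) → (zeroP *P p) ≋ zeroP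
*P-zeroˡ p = ≋-refl

*P-zeroʳ : ∀ {r} (p : Poly r) → (p *P zeroP) ≋ zeroP
*P-zeroʳ p = mk λ m → trans (coeff-* p [] m) (∑-zero p)

*P-identityˡ : ∀ {r} (p : Poly r) → (oneP *P p) ≋ p
*P-identityˡ p = mk λ m → begin
  coeff (oneP *P p) m ≡⟨ coeff-* oneP p m ⟩
  ∑ (λ t → termCoeff (termMul (1 , mon1) t) m) p + 0 ≡⟨ +-identityʳ _ ⟩
  ∑ (λ t → termCoeff (termMul (1 , mon1) t) m) p
    ≡⟨ ∑-cong p (λ { (c , u) → cong₂ (λ a b → termCoeff (a , b) m) (+-identityʳ c) (monMul-identityˡ u) }) ⟩
  ∑ (λ t → termCoeff t m) p ≡⟨ sym (coeff-∑ p m) ⟩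
  coeff p m ∎
  where open ≡-Reasoning

*P-identityʳ : ∀ {r} (p : Poly r) → (p *P oneP) ≋ p
*P-identityʳ p = ≋-trans (*P-comm p oneP) (*P-identityˡ p)

-- Polynomials in x₁,…,x_r,y modulo ≋ form a commutative semiring; this lets
-- the ring solver discharge the rearrangements of products and sums below.
PolySemiring : ℕ → CommutativeSemiring 0ℓ 0ℓ
PolySemiring r = record
  { Carrier = Poly r
  ; _≈_ = _≋_
  ; _+_ = _+P_
  ; _*_ = _*P_
  ; 0# = zeroP
  ; 1# = oneP
  ; isCommutativeSemiring = record
    { isSemiring = record
      { isSemiringWithoutAnnihilatingZero = record
        { +-isCommutativeMonoid = record
          { isMonoid = record
            { isSemigroup = record
              { isMagma = record
                { isEquivalence = record { refl = ≋-refl ; sym = ≋-sym ; trans = ≋-trans }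
                ; ∙-cong = +P-cong }
              ; assoc = +P-assoc }
            ; identity = +P-identityˡ , +P-identityʳ }
          ; comm = +P-comm }
        ; *-cong = *P-cong
        ; *-assoc = *P-assoc
        ; *-identity = *P-identityˡ , *P-identityʳ
        ; distrib = *P-distribˡ , (λ x y z → *P-distribʳ y z x) }
      ; zero = *P-zeroˡ , *P-zeroʳ }
    ; *-comm = *P-comm } }

infixr 7 _⊙_
_⊙_ : ∀ {r} → ℕ → Poly r → Poly r
zero ⊙ p = []
suc k ⊙ p = p ++ (k ⊙ p)

coeff-⊙ : ∀ {r} k (p : Poly r) m → coeff (k ⊙ p) m ≡ k * coeff p m
coeff-⊙ zero p m = refl
coeff-⊙ (suc k) p m = trans (coeff-+ p (k ⊙ p) m) (cong (coeff p m +_) (coeff-⊙ k p m))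

⊙-zero : ∀ {r} k → (k ⊙ zeroP {r}) ≋ zeroP
⊙-zero zero = ≋-refl
⊙-zero (suc k) = ⊙-zero k

⊙-cong : ∀ {r} k {p q : Poly r} → p ≋ q → (k ⊙ p) ≋ (k ⊙ q)
⊙-cong k {p} {q} e = mk λ m → trans (coeff-⊙ k p m) (trans (cong (k *_) (un e m)) (sym (coeff-⊙ k q m)))

⊙-*ˡ : ∀ {r} k (p q : Poly r) → ((k ⊙ p) *P q) ≋ (k ⊙ (p *P q))
⊙-*ˡ zero p q = ≋-refl
⊙-*ˡ (suc k) p q = ≋-trans (*P-distribʳ p (k ⊙ p) q) (+P-congʳ (p *P q) (⊙-*ˡ k p q))

⊙-*ʳ : ∀ {r} k (p q : Poly r) → (p *P (k ⊙ q)) ≋ (k ⊙ (p *P q))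
⊙-*ʳ k p q = ≋-trans (*P-comm p (k ⊙ q)) (≋-trans (⊙-*ˡ k q p) (⊙-cong k (*P-comm q p)))

⊙-+ : ∀ {r} k (p q : Poly r) → (k ⊙ (p +P q)) ≋ ((k ⊙ p) +P (k ⊙ q))
⊙-+ k p q = mk λ m → begin
  coeff (k ⊙ (p +P q)) m ≡⟨ coeff-⊙ k (p +P q) m ⟩
  k * coeff (p +P q) m ≡⟨ cong (k *_) (coeff-+ p q m) ⟩
  k * (coeff p m + coeff q m) ≡⟨ *-distribˡ-+ k _ _ ⟩
  k * coeff p m + k * coeff q m ≡⟨ sym (cong₂ _+_ (coeff-⊙ k p m) (coeff-⊙ k q m)) ⟩
  coeff (k ⊙ p) m + coeff (k ⊙ q) m ≡⟨ sym (coeff-+ (k ⊙ p) (k ⊙ q) m) ⟩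
  coeff ((k ⊙ p) +P (k ⊙ q)) m ∎
  where open ≡-Reasoning

coeff-sumP : ∀ {r} (f : A → Poly r) (xs : List A) m → coeff (sumP (map f xs)) m ≡ ∑ (λ x → coeff (f x) m) xs
coeff-sumP f [] m = refl
coeff-sumP f (x ∷ xs) m = trans (coeff-+ (f x) _ m) (cong (coeff (f x) m +_) (coeff-sumP f xs m))

Σ-cong : ∀ {r} {f g : A → Poly r} (xs : List A) → (∀ x → f x ≋ g x) → sumP (map f xs) ≋ sumP (map g xs)
Σ-cong [] e = ≋-refl
Σ-cong (x ∷ xs) e = +P-cong (e x) (Σ-cong xs e)

Σ-cong-All : ∀ {r} {P : A → Set} {f g : A → Poly r} {xs : List A} → All P xs → (∀ x → P x → f x ≋ g x) →
  sumP (map f xs) ≋ sumP (map g xs)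
Σ-cong-All [] h = ≋-refl
Σ-cong-All {xs = x ∷ xs} (px ∷ a) h = +P-cong (h x px) (Σ-cong-All a h)

Σ-zero : ∀ {r} (f : A → Poly r) (xs : List A) → (∀ x → f x ≋ zeroP) → sumP (map f xs) ≋ zeroP
Σ-zero f xs e = ≋-trans (Σ-cong xs e) (≡⇒≋ (zeros xs))
  where
  zeros : ∀ xs → sumP (map (λ _ → zeroP {_}) xs) ≡ zeroP
  zeros [] = refl
  zeros (x ∷ xs) = zeros xs

Σ-+ : ∀ {r} (f g : A → Poly r) (xs : List A) →
  sumP (map (λ x → f x +P g x) xs) ≋ (sumP (map f xs) +P sumP (map g xs))
Σ-+ f g xs = mk λ m → begin
  coeff (sumP (map (λ x → f x +P g x) xs)) m ≡⟨ coeff-sumP _ xs m ⟩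
  ∑ (λ x → coeff (f x +P g x) m) xs ≡⟨ ∑-cong xs (λ x → coeff-+ (f x) (g x) m) ⟩
  ∑ (λ x → coeff (f x) m + coeff (g x) m) xs ≡⟨ ∑-+ _ _ xs ⟩
  ∑ (λ x → coeff (f x) m) xs + ∑ (λ x → coeff (g x) m) xs ≡⟨ sym (cong₂ _+_ (coeff-sumP f xs m) (coeff-sumP g xs m)) ⟩
  coeff (sumP (map f xs)) m + coeff (sumP (map g xs)) m ≡⟨ sym (coeff-+ (sumP (map f xs)) _ m) ⟩
  coeff (sumP (map f xs) +P sumP (map g xs)) m ∎
  where open ≡-Reasoning

Σ-++ : ∀ {r} (f : A → Poly r) (xs ys : List A) → sumP (map f (xs ++ ys)) ≋ (sumP (map f xs) +P sumP (map f ys))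
Σ-++ f [] ys = ≋-refl
Σ-++ f (x ∷ xs) ys = ≋-trans (+P-congʳ (f x) (Σ-++ f xs ys)) (≋-sym (+P-assoc (f x) _ _))

Σ-map : ∀ {r} (f : B → Poly r) (g : A → B) (xs : List A) → sumP (map f (map g xs)) ≋ sumP (map (f ∘ g) xs)
Σ-map f g xs = ≡⇒≋ (cong sumP (sym (LP.map-∘ xs)))

Σ-concatMap : ∀ {r} (f : B → Poly r) (g : A → List B) (xs : List A) →
  sumP (map f (concatMap g xs)) ≋ sumP (map (λ x → sumP (map f (g x))) xs)
Σ-concatMap f g [] = ≋-refl
Σ-concatMap f g (x ∷ xs) = ≋-trans (Σ-++ f (g x) (concatMap g xs)) (+P-congʳ _ (Σ-concatMap f g xs))

Σ-*ʳ : ∀ {r} (f : A → Poly r) (xs : List A) (q : Poly r) →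
  (sumP (map f xs) *P q) ≋ sumP (map (λ x → f x *P q) xs)
Σ-*ʳ f [] q = ≋-refl
Σ-*ʳ f (x ∷ xs) q = ≋-trans (*P-distribʳ (f x) _ q) (+P-congʳ (f x *P q) (Σ-*ʳ f xs q))

Σ-*ˡ : ∀ {r} (q : Poly r) (f : A → Poly r) (xs : List A) →
  (q *P sumP (map f xs)) ≋ sumP (map (λ x → q *P f x) xs)
Σ-*ˡ q f xs = ≋-trans (*P-comm q _) (≋-trans (Σ-*ʳ f xs q) (Σ-cong xs (λ x → *P-comm (f x) q)))

Σ-⊙ : ∀ {r} k (f : A → Poly r) (xs : List A) → sumP (map (λ x → k ⊙ f x) xs) ≋ (k ⊙ sumP (map f xs))
Σ-⊙ k f [] = ≋-sym (⊙-zero k)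
Σ-⊙ k f (x ∷ xs) = ≋-trans (+P-congʳ (k ⊙ f x) (Σ-⊙ k f xs)) (≋-sym (⊙-+ k (f x) _))

-- Both ∂/∂x_i and ∂/∂y differentiate along one
-- coordinate of the exponent: c·u ↦ (c · exp u)·(u lowered by one).  We prove
-- once, for an abstract coordinate, that such a map respects ≋, is additive
-- and satisfies the Leibniz rule.

record Coordinate (r : ℕ) : Set where
  field
    exp : Mon r → ℕ
    lower : Mon r → Mon r
    raise : Mon r → Mon r
    exp-raise : ∀ m → exp (raise m) ≡ suc (exp m)
    lower-raise : ∀ m → lower (raise m) ≡ m
    raise-lower : ∀ u k → exp u ≡ suc k → raise (lower u) ≡ u
    exp-monMul : ∀ u v → exp (monMul u v) ≡ exp u + exp v
    lower-monMul : ∀ u v k → exp u ≡ suc k → lower (monMul u v) ≡ monMul (lower u) v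

module Derivative {r : ℕ} (κ : Coordinate r) where
  open Coordinate κ

  ∂T : Term r → Term r
  ∂T (c , u) = (c * exp u , lower u)

  ∂ : Poly r → Poly r
  ∂ = map ∂T

  -- Only the monomial raise m contributes to the coefficient of m in ∂ p.
  termCoeff-∂T : ∀ s m → termCoeff (∂T s) m ≡ suc (exp m) * termCoeff s (raise m)
  termCoeff-∂T (c , u) m with u ≟M raise m
  ... | yes refl = trans (iverson-yes (lower (raise m) ≟M m) _ (lower-raise m))
                         (trans (cong (c *_) (exp-raise m)) (*-comm c _))
  ... | no u≢raise = trans (vanishes (exp u) refl) (sym (*-zeroʳ (suc (exp m))))
    where
    vanishes : ∀ k → exp u ≡ k → iverson (lower u ≟M m) (c * exp u) ≡ 0
    vanishes zero e = trans (cong (iverson (lower u ≟M m)) (trans (cong (c *_) e) (*-zeroʳ c)))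
                            (iverson-zero (lower u ≟M m))
    vanishes (suc k) e = iverson-no (lower u ≟M m) _ λ lu≡m →
      u≢raise (trans (sym (raise-lower u k e)) (cong raise lu≡m))

  coeff-∂ : ∀ p m → coeff (∂ p) m ≡ suc (exp m) * coeff p (raise m)
  coeff-∂ p m = begin
    coeff (∂ p) m ≡⟨ coeff-∑ (∂ p) m ⟩
    ∑ (λ s → termCoeff s m) (∂ p) ≡⟨ ∑-map _ ∂T p ⟩
    ∑ (λ s → termCoeff (∂T s) m) p ≡⟨ ∑-cong p (λ s → termCoeff-∂T s m) ⟩
    ∑ (λ s → suc (exp m) * termCoeff s (raise m)) p ≡⟨ sym (∑-*ˡ (suc (exp m)) _ p) ⟩
    suc (exp m) * ∑ (λ s → termCoeff s (raise m)) p ≡⟨ cong (suc (exp m) *_) (sym (coeff-∑ p (raise m))) ⟩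
    suc (exp m) * coeff p (raise m) ∎
    where open ≡-Reasoning

  ∂-cong : ∀ {p q} → p ≋ q → ∂ p ≋ ∂ q
  ∂-cong {p} {q} e = mk λ m →
    trans (coeff-∂ p m) (trans (cong (suc (exp m) *_) (un e (raise m))) (sym (coeff-∂ q m)))

  ∂-+ : ∀ p q → ∂ (p +P q) ≋ (∂ p +P ∂ q)
  ∂-+ p q = ≡⇒≋ (LP.map-++ ∂T p q)

  -- A term c·e·w with exponent e = exp u only matters when e ≠ 0, that is,
  -- when u can be lowered.
  termCoeff-exp : (c : ℕ) (u w w′ m : Mon r) → (∀ k → exp u ≡ suc k → w ≡ w′) →
    termCoeff (c * exp u , w) m ≡ termCoeff (c * exp u , w′) m
  termCoeff-exp c u w w′ m same with exp u
  ... | zero = trans (vanishes w) (sym (vanishes w′))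
    where
    vanishes : (w : Mon r) → termCoeff (c * 0 , w) m ≡ 0
    vanishes w = trans (cong (λ z → termCoeff (z , w) m) (*-zeroʳ c)) (termCoeff-zero w m)
  ... | suc k rewrite same k refl = refl

  ∂T-termMul : ∀ s t m → termCoeff (∂T (termMul s t)) m ≡ termCoeff (termMul (∂T s) t) m + termCoeff (termMul s (∂T t)) m
  ∂T-termMul (c , u) (c′ , v) m = begin
    termCoeff (c * c′ * exp (monMul u v) , lower (monMul u v)) m
      ≡⟨ cong (λ z → termCoeff (z , lower (monMul u v)) m) split ⟩
    termCoeff ((c * c′) * exp u + (c * c′) * exp v , lower (monMul u v)) m
      ≡⟨ termCoeff-+ _ _ (lower (monMul u v)) m ⟩
    termCoeff ((c * c′) * exp u , lower (monMul u v)) m + termCoeff ((c * c′) * exp v , lower (monMul u v)) m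
      ≡⟨ cong₂ _+_ (termCoeff-exp (c * c′) u _ (monMul (lower u) v) m (lower-monMul u v))
                   (termCoeff-exp (c * c′) v _ (monMul u (lower v)) m (λ k e → trans (cong lower (monMul-comm u v))
                                                       (trans (lower-monMul v u k e) (monMul-comm _ u)))) ⟩
    termCoeff ((c * c′) * exp u , monMul (lower u) v) m + termCoeff ((c * c′) * exp v , monMul u (lower v)) m
      ≡⟨ cong₂ (λ a b → termCoeff (a , monMul (lower u) v) m + termCoeff (b , monMul u (lower v)) m)
               (solve 3 (λ c c′ e → (c :* c′) :* e := (c :* e) :* c′) refl c c′ (exp u))
               (*-assoc c c′ (exp v)) ⟩
    termCoeff (c * exp u * c′ , monMul (lower u) v) m + termCoeff (c * (c′ * exp v) , monMul u (lower v)) m ∎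
    where
    open ≡-Reasoning
    open import Data.Nat.Solver using (module +-*-Solver)
    open +-*-Solver
    split : c * c′ * exp (monMul u v) ≡ (c * c′) * exp u + (c * c′) * exp v
    split = trans (cong (c * c′ *_) (exp-monMul u v)) (*-distribˡ-+ (c * c′) (exp u) (exp v))

  ∂-leibniz : ∀ p q → ∂ (p *P q) ≋ ((∂ p *P q) +P (p *P ∂ q))
  ∂-leibniz p q = mk λ m → begin
    coeff (∂ (p *P q)) m ≡⟨ coeff-∑ (∂ (p *P q)) m ⟩
    ∑ (λ w → termCoeff w m) (∂ (p *P q)) ≡⟨ ∑-map _ ∂T (p *P q) ⟩
    ∑ (λ w → termCoeff (∂T w) m) (p *P q) ≡⟨ ∑-*P _ p q ⟩
    ∑ (λ s → ∑ (λ t → termCoeff (∂T (termMul s t)) m) q) p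
      ≡⟨ ∑-cong p (λ s → trans (∑-cong q (λ t → ∂T-termMul s t m)) (∑-+ _ _ q)) ⟩
    ∑ (λ s → ∑ (λ t → termCoeff (termMul (∂T s) t) m) q + ∑ (λ t → termCoeff (termMul s (∂T t)) m) q) p
      ≡⟨ ∑-+ _ _ p ⟩
    ∑ (λ s → ∑ (λ t → termCoeff (termMul (∂T s) t) m) q) p + ∑ (λ s → ∑ (λ t → termCoeff (termMul s (∂T t)) m) q) p
      ≡⟨ cong₂ _+_ (sym (∑-map (λ s → ∑ (λ t → termCoeff (termMul s t) m) q) ∂T p))
                   (∑-cong p (λ s → sym (∑-map (λ t → termCoeff (termMul s t) m) ∂T q))) ⟩
    ∑ (λ s → ∑ (λ t → termCoeff (termMul s t) m) q) (∂ p) + ∑ (λ s → ∑ (λ t → termCoeff (termMul s t) m) (∂ q)) p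
      ≡⟨ sym (cong₂ _+_ (coeff-* (∂ p) q m) (coeff-* p (∂ q) m)) ⟩
    coeff (∂ p *P q) m + coeff (p *P ∂ q) m ≡⟨ sym (coeff-+ (∂ p *P q) _ m) ⟩
    coeff ((∂ p *P q) +P (p *P ∂ q)) m ∎
    where open ≡-Reasoning

xCoord : ∀ {r} → Fin r → Coordinate r
xCoord i = record
  { exp = λ { (a , b) → lookup a i }
  ; lower = λ { (a , b) → (a [ i ]%= pred , b) }
  ; raise = λ { (a , b) → (a [ i ]%= suc , b) }
  ; exp-raise = λ { (a , b) → VP.lookup∘updateAt i a }
  ; lower-raise = λ { (a , b) → cong (_, b) (trans (VP.updateAt-updateAt i a) (VP.updateAt-id-local i a refl)) }
  ; raise-lower = λ { (a , b) k e → cong (_, b) (trans (VP.updateAt-updateAt i a)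
                        (VP.updateAt-id-local i a (trans (cong (suc ∘ pred) e) (sym e)))) }
  ; exp-monMul = λ { (a , b) (a′ , b′) → VP.lookup-zipWith _+_ i a a′ }
  ; lower-monMul = λ { (a , b) (a′ , b′) k e → cong (_, b + b′) (pred-vadd a a′ i e) }
  }
  where
  pred-vadd : ∀ {r} (a b : Vec ℕ r) i {k} → lookup a i ≡ suc k → (vadd a b [ i ]%= pred) ≡ vadd (a [ i ]%= pred) b
  pred-vadd (x V.∷ a) (y V.∷ b) 𝔽.zero refl = refl
  pred-vadd (x V.∷ a) (y V.∷ b) (𝔽.suc i) e = cong (x + y V.∷_) (pred-vadd a b i e)

yCoord : ∀ {r} → Coordinate r
yCoord = record
  { exp = proj₂
  ; lower = λ { (a , b) → (a , pred b) }
  ; raise = λ { (a , b) → (a , suc b) }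
  ; exp-raise = λ _ → refl
  ; lower-raise = λ _ → refl
  ; raise-lower = λ { (a , b) k refl → refl }
  ; exp-monMul = λ _ _ → refl
  ; lower-monMul = λ { (a , b) (a′ , b′) k refl → refl }
  }

-- Defs' ∂x i and ∂y are, definitionally, the derivatives along these coordinates.
module ∂x {r} (i : Fin r) = Derivative (xCoord {r} i)
module ∂y {r} = Derivative (yCoord {r})

dCoeff : ∀ {r} → Fin r → Poly r
dCoeff i = xVar i *P sumP (map xVar (others i))

Dr-cong : ∀ {r} {p q : Poly r} → p ≋ q → Dr p ≋ Dr q
Dr-cong {r} e = Σ-cong (allFin r) (λ i → *P-congʳ (dCoeff i) (∂x.∂-cong i e))

Dr-+ : ∀ {r} (p q : Poly r) → Dr (p +P q) ≋ (Dr p +P Dr q)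
Dr-+ {r} p q =
  Dr (p +P q)
    ≋⟨ Σ-cong (allFin r) (λ i → ≋-trans (*P-congʳ (dCoeff i) (∂x.∂-+ i p q)) (*P-distribˡ (dCoeff i) _ _)) ⟩
  sumP (map (λ i → (dCoeff i *P ∂x i p) +P (dCoeff i *P ∂x i q)) (allFin r))
    ≋⟨ Σ-+ _ _ (allFin r) ⟩
  (Dr p +P Dr q) ∎P

Dr-zero : ∀ {r} → Dr {r} zeroP ≋ zeroP
Dr-zero {r} = Σ-zero _ (allFin r) (λ i → *P-zeroʳ (dCoeff i))

Dr-Σ : ∀ {r} (f : A → Poly r) (xs : List A) → Dr (sumP (map f xs)) ≋ sumP (map (λ x → Dr (f x)) xs)
Dr-Σ f [] = Dr-zero
Dr-Σ f (x ∷ xs) = ≋-trans (Dr-+ (f x) _) (+P-congʳ (Dr (f x)) (Dr-Σ f xs))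

Dr-leibniz : ∀ {r} (p q : Poly r) → Dr (p *P q) ≋ ((Dr p *P q) +P (p *P Dr q))
Dr-leibniz {r} p q =
  Dr (p *P q)
    ≋⟨ Σ-cong (allFin r) (λ i → ≋-trans (*P-congʳ (dCoeff i) (∂x.∂-leibniz i p q))
                                         (distribute (dCoeff i) (∂x i p) q p (∂x i q))) ⟩
  sumP (map (λ i → ((dCoeff i *P ∂x i p) *P q) +P (p *P (dCoeff i *P ∂x i q))) (allFin r))
    ≋⟨ Σ-+ _ _ (allFin r) ⟩
  (sumP (map (λ i → (dCoeff i *P ∂x i p) *P q) (allFin r)) +P sumP (map (λ i → p *P (dCoeff i *P ∂x i q)) (allFin r)))
    ≋⟨ +P-cong (≋-sym (Σ-*ʳ (λ i → dCoeff i *P ∂x i p) (allFin r) q))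
               (≋-sym (Σ-*ˡ p (λ i → dCoeff i *P ∂x i q) (allFin r))) ⟩
  ((Dr p *P q) +P (p *P Dr q)) ∎P
  where
  open import Algebra.Solver.Ring.NaturalCoefficients.Default (PolySemiring r)
  distribute : (c a b a′ b′ : Poly r) → (c *P ((a *P b) +P (a′ *P b′))) ≋ (((c *P a) *P b) +P (a′ *P (c *P b′)))
  distribute = solve 5 (λ c a b a′ b′ → c :* ((a :* b) :+ (a′ :* b′)) := ((c :* a) :* b) :+ (a′ :* (c :* b′))) ≋-refl

Dr-yPow : ∀ {r} k → Dr (yPow {r} k) ≋ zeroP
Dr-yPow {r} k = Σ-zero _ (allFin r) (λ i → ≋-trans (*P-congʳ (dCoeff i) (∂x-yPow i)) (*P-zeroʳ (dCoeff i)))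
  where
  ∂x-yPow : ∀ i → ∂x i (yPow {r} k) ≋ zeroP
  ∂x-yPow i = ≋-trans (single-≡ (cong (1 *_) (VP.lookup-replicate i 0)) refl) (single-zero _)

YFree : ∀ {r} → Poly r → Set
YFree = All (λ s → proj₂ (proj₂ s) ≡ 0)

∂y-YFree : ∀ {r} {p : Poly r} → YFree p → ∂y p ≋ zeroP
∂y-YFree {p = p} free = mk λ m → trans (∂y.coeff-∂ p m)
  (trans (cong (suc (proj₂ m) *_) (noY free (proj₁ m) (proj₂ m))) (*-zeroʳ (suc (proj₂ m))))
  where
  noY : ∀ {p} → YFree p → ∀ a k → coeff p (a , suc k) ≡ 0
  noY [] a k = refl
  noY {(c , (a′ , b)) ∷ p} (b≡0 ∷ free) a k =
    cong₂ _+_ (iverson-no ((a′ , b) ≟M (a , suc k)) c (λ e → 0≢1+n (trans (sym b≡0) (cong proj₂ e)))) (noY free a k)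

YFree-* : ∀ {r} {p q : Poly r} → YFree p → YFree q → YFree (p *P q)
YFree-* [] free-q = []
YFree-* {q = q} (b≡0 ∷ free-p) free-q = AllP.++⁺ (AllP.map⁺ (All.map (cong₂ _+_ b≡0) free-q)) (YFree-* free-p free-q)

xS : ∀ {r} → Vec Bool r → Poly r
xS S = (1 , subsetMon S) ∷ []

ofSize : (r d : ℕ) → List (Vec Bool r)
ofSize r d = filter (λ S → card S ≟ d) (allSubsets r)

esym-as-sum : ∀ r d → esym r d ≡ sumP (map xS (ofSize r d))
esym-as-sum r d = monomials (ofSize r d)
  where
  monomials : ∀ L → map (λ S → (1 , subsetMon S)) L ≡ sumP (map xS L)
  monomials [] = refl
  monomials (S ∷ L) = cong (_ ∷_) (monomials L)

ofSize-card : ∀ r d → All (λ S → card S ≡ d) (ofSize r d)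
ofSize-card r d = AllP.all-filter (λ S → card S ≟ d) (allSubsets r)

-- Subsets of {0,…,r} split according to whether they contain 0; those that do
-- have size d exactly when the rest has size d − 1.

ofSize⁻ : (r d : ℕ) → List (Vec Bool r)
ofSize⁻ r d = filter (λ S → suc (card S) ≟ d) (allSubsets r)

ofSize-suc : ∀ r d → ofSize (suc r) d ≡ map (true V.∷_) (ofSize⁻ r d) ++ map (false V.∷_) (ofSize r d)
ofSize-suc r d =
  trans (LP.filter-++ (λ S → card S ≟ d) (map (true V.∷_) (allSubsets r)) _)
        (cong₂ _++_ (filter-map (true V.∷_) (allSubsets r)) (filter-map (false V.∷_) (allSubsets r)))
  where
  filter-map : (f : Vec Bool r → Vec Bool (suc r)) (xs : List (Vec Bool r)) →
    filter (λ S → card S ≟ d) (map f xs) ≡ map f (filter (λ S → card (f S) ≟ d) xs)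
  filter-map f [] = refl
  filter-map f (x ∷ xs) with does (card (f x) ≟ d)
  ... | true = cong (f x ∷_) (filter-map f xs)
  ... | false = filter-map f xs

ofSize⁻-zero : ∀ r → ofSize⁻ r 0 ≡ []
ofSize⁻-zero r = LP.filter-none (λ S → suc (card S) ≟ 0) {xs = allSubsets r} (All.tabulate (λ _ ()))

ofSize⁻-suc : ∀ r d → ofSize⁻ r (suc d) ≡ ofSize r d
ofSize⁻-suc r d = LP.filter-≐ (λ S → suc (card S) ≟ suc d) (λ S → card S ≟ d) (suc-injective , cong suc) (allSubsets r)

Σ-ofSize-suc : ∀ {r} (f : Vec Bool (suc r) → Poly (suc r)) d →
  sumP (map f (ofSize (suc r) d)) ≋ (sumP (map (λ S → f (true V.∷ S)) (ofSize⁻ r d)) +P sumP (map (λ S → f (false V.∷ S)) (ofSize r d)))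
Σ-ofSize-suc {r} f d rewrite ofSize-suc r d =
  ≋-trans (Σ-++ f (map (true V.∷_) (ofSize⁻ r d)) _) (+P-cong (Σ-map f _ (ofSize⁻ r d)) (Σ-map f _ (ofSize r d)))

x₀^_·_ : ∀ {r} → ℕ → Poly r → Poly (suc r)
x₀^ e · p = map (λ { (c , (a , b)) → (c , (e V.∷ a , b)) }) p

coeff-x₀ : ∀ {r} e (p : Poly r) a₀ a b → coeff (x₀^ e · p) (a₀ V.∷ a , b) ≡ iverson (e ≟ a₀) (coeff p (a , b))
coeff-x₀ e [] a₀ a b = sym (iverson-zero (e ≟ a₀))
coeff-x₀ e ((c , (a′ , b′)) ∷ p) a₀ a b =
  trans (cong₂ _+_ (head (e ≟ a₀)) (coeff-x₀ e p a₀ a b)) (sym (iverson-+ (e ≟ a₀) _ _))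
  where
  head : (d : Dec (e ≡ a₀)) → iverson ((e V.∷ a′ , b′) ≟M (a₀ V.∷ a , b)) c ≡ iverson d (iverson ((a′ , b′) ≟M (a , b)) c)
  head (yes refl) = iverson-⇔ ((e V.∷ a′ , b′) ≟M (e V.∷ a , b)) ((a′ , b′) ≟M (a , b)) c
                     (λ eq → cong₂ _,_ (VP.∷-injectiveʳ (cong proj₁ eq)) (cong proj₂ eq))
                     (λ eq → cong₂ _,_ (cong (e V.∷_) (cong proj₁ eq)) (cong proj₂ eq))
  head (no e≢a₀) = iverson-no ((e V.∷ a′ , b′) ≟M (a₀ V.∷ a , b)) c (λ eq → e≢a₀ (VP.∷-injectiveˡ (cong proj₁ eq)))

x₀-cong : ∀ {r} e {p q : Poly r} → p ≋ q → (x₀^ e · p) ≋ (x₀^ e · q)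
x₀-cong e {p} {q} eq = mk λ { (a₀ V.∷ a , b) →
  trans (coeff-x₀ e p a₀ a b) (trans (cong (iverson (e ≟ a₀)) (un eq (a , b))) (sym (coeff-x₀ e q a₀ a b))) }

x₀-+ : ∀ {r} e (p q : Poly r) → (x₀^ e · (p +P q)) ≡ ((x₀^ e · p) +P (x₀^ e · q))
x₀-+ e p q = LP.map-++ _ p q

x₀-⊙ : ∀ {r} e k (p : Poly r) → (x₀^ e · (k ⊙ p)) ≡ (k ⊙ (x₀^ e · p))
x₀-⊙ e zero p = refl
x₀-⊙ e (suc k) p = trans (x₀-+ e p (k ⊙ p)) (cong ((x₀^ e · p) ++_) (x₀-⊙ e k p))

x₀-* : ∀ {r} e e′ (p q : Poly r) → ((x₀^ e · p) *P (x₀^ e′ · q)) ≡ (x₀^ (e + e′) · (p *P q))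
x₀-* e e′ [] q = refl
x₀-* e e′ (s ∷ p) q = trans (cong₂ _++_ (sym (LP.map-∘ q)) (x₀-* e e′ p q))
  (trans (cong (_++ _) (LP.map-∘ q)) (sym (x₀-+ (e + e′) _ (p *P q))))

x₀-Σ : ∀ {r} e (f : A → Poly r) (xs : List A) → (x₀^ e · sumP (map f xs)) ≡ sumP (map (λ x → x₀^ e · f x) xs)
x₀-Σ e f [] = refl
x₀-Σ e f (x ∷ xs) = trans (x₀-+ e (f x) _) (cong ((x₀^ e · f x) ++_) (x₀-Σ e f xs))

esym-suc : ∀ r d → sumP (map xS (ofSize (suc r) (suc d))) ≋ ((x₀^ 1 · sumP (map xS (ofSize r d))) +P (x₀^ 0 · sumP (map xS (ofSize r (suc d)))))
esym-suc r d rewrite x₀-Σ 1 xS (ofSize r d) | x₀-Σ 0 xS (ofSize r (suc d)) | sym (ofSize⁻-suc r d) =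
  Σ-ofSize-suc xS (suc d)

e₁ : ∀ {r} → Poly r
e₁ {r} = sumP (map xVar (allFin r))

eΣ : (r d : ℕ) → Poly r
eΣ r d = sumP (map xS (ofSize r d))

onlyIf : Bool → ℕ → ℕ
onlyIf b c = if b then c else 0

outside : ∀ {r} → Vec Bool r → Poly r
outside {r} S = sumP (map (λ j → if lookup S j then zeroP else (xVar j *P xS S)) (allFin r))

Σ-allFin-suc : ∀ {r} (g : Fin (suc r) → Poly (suc r)) →
  sumP (map g (allFin (suc r))) ≡ (g 𝔽.zero +P sumP (map (g ∘ 𝔽.suc) (allFin r)))
Σ-allFin-suc {r} g = trans (cong (λ L → sumP (map g L)) (allFin-suc r))
                           (cong ((g 𝔽.zero) ++_) (cong sumP (sym (LP.map-∘ (allFin r)))))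

outside-true : ∀ {r} (S : Vec Bool r) → outside (true V.∷ S) ≡ (x₀^ 1 · outside S)
outside-true {r} S = trans (Σ-allFin-suc (λ j → if lookup (true V.∷ S) j then zeroP else (xVar j *P xS (true V.∷ S))))
  (trans (cong sumP (LP.map-cong (λ j → shifted (lookup S j) j) (allFin r))) (sym (x₀-Σ 1 _ (allFin r))))
  where
  shifted : ∀ b j → (if b then zeroP else (xVar (𝔽.suc j) *P xS (true V.∷ S))) ≡ (x₀^ 1 · (if b then zeroP else (xVar j *P xS S)))
  shifted true j = refl
  shifted false j = x₀-* 0 1 (xVar j) (xS S)

outside-false : ∀ {r} (S : Vec Bool r) → outside (false V.∷ S) ≋ ((x₀^ 1 · xS S) +P (x₀^ 0 · outside S))
outside-false {r} S =
  ≋-trans (≡⇒≋ (Σ-allFin-suc (λ j → if lookup (false V.∷ S) j then zeroP else (xVar j *P xS (false V.∷ S)))))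
    (+P-cong (≋-trans (≡⇒≋ (x₀-* 1 0 oneP (xS S))) (x₀-cong 1 (*P-identityˡ (xS S))))
             (≡⇒≋ (trans (cong sumP (LP.map-cong (λ j → shifted (lookup S j) j) (allFin r))) (sym (x₀-Σ 0 _ (allFin r))))))
  where
  shifted : ∀ b j → (if b then zeroP else (xVar (𝔽.suc j) *P xS (false V.∷ S))) ≡ (x₀^ 0 · (if b then zeroP else (xVar j *P xS S)))
  shifted true j = refl
  shifted false j = x₀-* 0 0 (xVar j) (xS S)

-- For a single monomial x^S:  D_r x^S + e₁ x^S = |S| e₁ x^S + Σ_{j∉S} x_j x^S,
-- since x_i ∂x^S/∂x_i = [i ∈ S] x^S and D_r = Σ_i (Σ_{j≠i} x_j) x_i ∂/∂x_i.

bit : Bool → ℕ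
bit b = if b then 1 else 0

card-∑ : ∀ {n} (S : Vec Bool n) → card S ≡ ∑ (λ i → bit (lookup S i)) (allFin n)
card-∑ V.[] = refl
card-∑ (b V.∷ S) = trans (cong (bit b +_) (card-∑ S)) (sym (∑-allFin-suc (λ i → bit (lookup (b V.∷ S) i))))

x∂x-xS : ∀ {r} (S : Vec Bool r) (i : Fin r) → (xVar i *P ∂x i (xS S)) ≋ (if lookup S i then xS S else zeroP)
x∂x-xS {r} S i with lookup S i in S[i]
... | true = single-≡ (cong (λ z → 1 * (1 * z)) exponent) (cong (_, 0) (unit+lowered (V.map bit S) i exponent))
  where
  exponent : lookup (V.map bit S) i ≡ 1
  exponent = trans (VP.lookup-map i bit S) (cong bit S[i])
  unit+lowered : ∀ {r} (v : Vec ℕ r) i {k} → lookup v i ≡ suc k → vadd (replicate r 0 [ i ]%= suc) (v [ i ]%= pred) ≡ v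
  unit+lowered (x V.∷ v) 𝔽.zero refl = cong (x V.∷_) (vadd-identityˡ v)
  unit+lowered (x V.∷ v) (𝔽.suc i) e = cong (x V.∷_) (unit+lowered v i e)
... | false = ≋-trans (single-≡ (cong (λ z → 1 * (1 * z)) (trans (VP.lookup-map i bit S) (cong bit S[i]))) refl)
                      (single-zero _)

coeff-x*P : ∀ {r} (xs : List (Fin r)) (p : Poly r) m →
  coeff (sumP (map xVar xs) *P p) m ≡ ∑ (λ j → coeff (xVar j *P p) m) xs
coeff-x*P xs p m = trans (un (Σ-*ʳ xVar xs p) m) (coeff-sumP (λ j → xVar j *P p) xs m)

coeff-Dr-xS : ∀ {r} (S : Vec Bool r) m → coeff (Dr (xS S)) m ≡
  ∑ (λ i → onlyIf (lookup S i) (∑ (λ j → coeff (xVar j *P xS S) m) (others i))) (allFin r)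
coeff-Dr-xS {r} S m = trans (coeff-sumP (λ i → dCoeff i *P ∂x i (xS S)) (allFin r) m) (∑-cong (allFin r) term)
  where
  open import Algebra.Solver.Ring.NaturalCoefficients.Default (PolySemiring r)
  regroup : (x o d : Poly r) → ((x *P o) *P d) ≋ (o *P (x *P d))
  regroup = solve 3 (λ x o d → (x :* o) :* d := o :* (x :* d)) ≋-refl
  byMembership : ∀ i b → coeff (sumP (map xVar (others i)) *P (if b then xS S else zeroP)) m
                       ≡ onlyIf b (∑ (λ j → coeff (xVar j *P xS S) m) (others i))
  byMembership i true = coeff-x*P (others i) (xS S) m
  byMembership i false = un (*P-zeroʳ (sumP (map xVar (others i)))) m
  term : ∀ i → coeff (dCoeff i *P ∂x i (xS S)) m ≡ onlyIf (lookup S i) (∑ (λ j → coeff (xVar j *P xS S) m) (others i))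
  term i = trans (un (regroup (xVar i) (sumP (map xVar (others i))) (∂x i (xS S))) m)
                 (trans (un (*P-congʳ (sumP (map xVar (others i))) (x∂x-xS S i)) m) (byMembership i (lookup S i)))

coeff-outside : ∀ {r} (S : Vec Bool r) m →
  coeff (outside S) m ≡ ∑ (λ j → if lookup S j then 0 else coeff (xVar j *P xS S) m) (allFin r)
coeff-outside {r} S m = trans (coeff-sumP _ (allFin r) m) (∑-cong (allFin r) (λ j → byMembership j (lookup S j)))
  where
  byMembership : ∀ j b → coeff (if b then zeroP else (xVar j *P xS S)) m ≡ (if b then 0 else coeff (xVar j *P xS S) m)
  byMembership j true = refl
  byMembership j false = refl

count-identity : ∀ {n} (S : Vec Bool n) (f : Fin n → ℕ) →
  ∑ (λ i → onlyIf (lookup S i) (∑ f (others i))) (allFin n) + ∑ f (allFin n)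
  ≡ card S * ∑ f (allFin n) + ∑ (λ j → if lookup S j then 0 else f j) (allFin n)
count-identity {n} S f = sym (begin
  card S * G + N ≡⟨ cong (λ z → z * G + N) (card-∑ S) ⟩
  ∑ (λ i → bit (lookup S i)) (allFin n) * G + N ≡⟨ cong (_+ N) (trans (*-comm _ G) (∑-*ˡ G _ (allFin n))) ⟩
  ∑ (λ i → G * bit (lookup S i)) (allFin n) + N ≡⟨ cong (_+ N) (∑-cong (allFin n) (λ i → splitG (lookup S i) i)) ⟩
  ∑ (λ i → onlyIf (lookup S i) (Others i) + onlyIf (lookup S i) (f i)) (allFin n) + N ≡⟨ cong (_+ N) (∑-+ _ _ (allFin n)) ⟩
  (∑ (λ i → onlyIf (lookup S i) (Others i)) (allFin n) + ∑ (λ i → onlyIf (lookup S i) (f i)) (allFin n)) + N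
    ≡⟨ +-assoc (∑ (λ i → onlyIf (lookup S i) (Others i)) (allFin n)) _ N ⟩
  ∑ (λ i → onlyIf (lookup S i) (Others i)) (allFin n) + (∑ (λ i → onlyIf (lookup S i) (f i)) (allFin n) + N)
    ≡⟨ cong (∑ (λ i → onlyIf (lookup S i) (Others i)) (allFin n) +_)
            (trans (sym (∑-+ _ _ (allFin n))) (∑-cong (allFin n) (λ i → inOrOut (lookup S i) (f i)))) ⟩
  ∑ (λ i → onlyIf (lookup S i) (Others i)) (allFin n) + G ∎)
  where
  open ≡-Reasoning
  G = ∑ f (allFin n)
  N = ∑ (λ j → if lookup S j then 0 else f j) (allFin n)
  Others : Fin n → ℕ
  Others i = ∑ f (others i)
  splitG : ∀ b i → G * bit b ≡ onlyIf b (Others i) + onlyIf b (f i)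
  splitG true i = trans (*-identityʳ G) (sym (∑-others f i))
  splitG false i = *-zeroʳ G
  inOrOut : ∀ b x → onlyIf b x + (if b then 0 else x) ≡ x
  inOrOut true x = +-identityʳ x
  inOrOut false x = refl

subset-identity : ∀ {r} (S : Vec Bool r) → (Dr (xS S) +P (e₁ *P xS S)) ≋ ((card S ⊙ (e₁ *P xS S)) +P outside S)
subset-identity {r} S = mk λ m → begin
  coeff (Dr (xS S) +P (e₁ *P xS S)) m ≡⟨ coeff-+ (Dr (xS S)) _ m ⟩
  coeff (Dr (xS S)) m + coeff (e₁ *P xS S) m ≡⟨ cong₂ _+_ (coeff-Dr-xS S m) (coeff-x*P (allFin r) (xS S) m) ⟩
  _ ≡⟨ count-identity S (λ j → coeff (xVar j *P xS S) m) ⟩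
  card S * ∑ (λ j → coeff (xVar j *P xS S) m) (allFin r) + ∑ (λ j → if lookup S j then 0 else coeff (xVar j *P xS S) m) (allFin r)
    ≡⟨ cong₂ _+_ (trans (cong (card S *_) (sym (coeff-x*P (allFin r) (xS S) m))) (sym (coeff-⊙ (card S) _ m)))
                 (sym (coeff-outside S m)) ⟩
  coeff (card S ⊙ (e₁ *P xS S)) m + coeff (outside S) m ≡⟨ sym (coeff-+ (card S ⊙ (e₁ *P xS S)) _ m) ⟩
  coeff ((card S ⊙ (e₁ *P xS S)) +P outside S) m ∎
  where open ≡-Reasoning

-- Σ_{|S|=d} Σ_{j∉S} x_j x^S = (d+1) e_{d+1}: each (d+1)-subset T arises from
-- the d+1 pairs (T∖{j}, j), j ∈ T.  By induction on r, splitting off x₀.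

outside-sum : ∀ r d → sumP (map outside (ofSize r d)) ≋ (suc d ⊙ eΣ r (suc d))
outside-sum zero zero = ≋-sym (⊙-zero 1)
outside-sum zero (suc d) = ≋-sym (⊙-zero (suc (suc d)))
outside-sum (suc r) d =
  sumP (map outside (ofSize (suc r) d))
    ≋⟨ Σ-ofSize-suc outside d ⟩
  (sumP (map (λ S → outside (true V.∷ S)) (ofSize⁻ r d)) +P sumP (map (λ S → outside (false V.∷ S)) (ofSize r d)))
    ≋⟨ +P-cong (≡⇒≋ (trans (cong sumP (LP.map-cong outside-true (ofSize⁻ r d))) (sym (x₀-Σ 1 outside (ofSize⁻ r d)))))
               (≋-trans (Σ-cong (ofSize r d) outside-false)
                        (≋-trans (Σ-+ _ _ (ofSize r d))
                                 (≡⇒≋ (sym (cong₂ _+P_ (x₀-Σ 1 xS (ofSize r d)) (x₀-Σ 0 outside (ofSize r d))))))) ⟩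
  ((x₀^ 1 · sumP (map outside (ofSize⁻ r d))) +P ((x₀^ 1 · eΣ r d) +P (x₀^ 0 · sumP (map outside (ofSize r d)))))
    ≋⟨ +P-cong (x₀-cong 1 (below d)) (+P-congʳ (x₀^ 1 · eΣ r d) (x₀-cong 0 (outside-sum r d))) ⟩
  ((x₀^ 1 · (d ⊙ eΣ r d)) +P ((x₀^ 1 · eΣ r d) +P (x₀^ 0 · (suc d ⊙ eΣ r (suc d)))))
    ≋⟨ ≡⇒≋ (cong₂ (λ a b → a +P ((x₀^ 1 · eΣ r d) +P b)) (x₀-⊙ 1 d (eΣ r d)) (x₀-⊙ 0 (suc d) (eΣ r (suc d)))) ⟩
  ((d ⊙ withX₀) +P (withX₀ +P (suc d ⊙ withoutX₀)))
    ≋⟨ regroup (d ⊙ withX₀) withX₀ (suc d ⊙ withoutX₀) ⟩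
  ((suc d ⊙ withX₀) +P (suc d ⊙ withoutX₀))
    ≋⟨ ≋-sym (⊙-+ (suc d) withX₀ withoutX₀) ⟩
  (suc d ⊙ (withX₀ +P withoutX₀))
    ≋⟨ ⊙-cong (suc d) (≋-sym (esym-suc r d)) ⟩
  (suc d ⊙ eΣ (suc r) (suc d)) ∎P
  where
  withX₀ withoutX₀ : Poly (suc r)
  withX₀ = x₀^ 1 · eΣ r d
  withoutX₀ = x₀^ 0 · eΣ r (suc d)
  below : ∀ d → sumP (map outside (ofSize⁻ r d)) ≋ (d ⊙ eΣ r d)
  below zero rewrite ofSize⁻-zero r = ≋-refl
  below (suc d) rewrite ofSize⁻-suc r d = outside-sum r d
  open import Algebra.Solver.Ring.NaturalCoefficients.Default (PolySemiring (suc r))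
  regroup : (x a y : Poly (suc r)) → (x +P (a +P y)) ≋ ((a +P x) +P y)
  regroup = solve 3 (λ x a y → x :+ (a :+ y) := (a :+ x) :+ y) ≋-refl

-- The identity for e_d: sum the single-monomial identity over |S| = d.
esym-identity : ∀ r d → (Dr (esym r d) +P (e₁ *P esym r d)) ≋ ((d ⊙ (e₁ *P esym r d)) +P (suc d ⊙ esym r (suc d)))
esym-identity r d rewrite esym-as-sum r d | esym-as-sum r (suc d) =
  (Dr (eΣ r d) +P (e₁ *P eΣ r d))
    ≋⟨ +P-cong (Dr-Σ xS Sd) (Σ-*ˡ e₁ xS Sd) ⟩
  (sumP (map (λ S → Dr (xS S)) Sd) +P sumP (map (λ S → e₁ *P xS S) Sd))
    ≋⟨ ≋-sym (Σ-+ _ _ Sd) ⟩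
  sumP (map (λ S → Dr (xS S) +P (e₁ *P xS S)) Sd)
    ≋⟨ Σ-cong-All (ofSize-card r d) (λ S |S|≡d → ≋-trans (subset-identity S)
                                                  (≡⇒≋ (cong (λ k → (k ⊙ (e₁ *P xS S)) +P outside S) |S|≡d))) ⟩
  sumP (map (λ S → (d ⊙ (e₁ *P xS S)) +P outside S) Sd)
    ≋⟨ Σ-+ _ _ Sd ⟩
  (sumP (map (λ S → d ⊙ (e₁ *P xS S)) Sd) +P sumP (map outside Sd))
    ≋⟨ +P-cong (≋-trans (Σ-⊙ d (λ S → e₁ *P xS S) Sd) (⊙-cong d (≋-sym (Σ-*ˡ e₁ xS Sd)))) (outside-sum r d) ⟩
  ((d ⊙ (e₁ *P eΣ r d)) +P (suc d ⊙ eΣ r (suc d))) ∎P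
  where
  Sd = ofSize r d

-- e₀ = 1: a leaf has weight 1.
esym-zero : ∀ r → esym r 0 ≋ oneP
esym-zero r rewrite esym-as-sum r 0 = eΣ-zero r
  where
  eΣ-zero : ∀ r → eΣ r 0 ≋ oneP
  eΣ-zero zero = ≋-refl
  eΣ-zero (suc r) rewrite ofSize-suc r 0 | ofSize⁻-zero r =
    ≋-trans (Σ-map xS (false V.∷_) (ofSize r 0)) (≋-trans (≡⇒≋ (sym (x₀-Σ 0 xS (ofSize r 0)))) (x₀-cong 0 (eΣ-zero r)))


-- The insertion generator: forests on [n+1] from forests on [n], by adding
-- the label l = n+1 as a leaf.

leaf : ℕ → Tree
leaf l = node l []

insLeaf : Tree → List Tree → List (List Tree)
insLeaf x [] = (x ∷ []) ∷ []
insLeaf x (t ∷ ts) = (x ∷ t ∷ ts) ∷ map (t ∷_) (insLeaf x ts)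

mutual
  insT : ℕ → Tree → List Tree
  insT l (node a ts) = map (node a) (insLeaf (leaf l) ts ++ insF l ts)

  insF : ℕ → List Tree → List (List Tree)
  insF l [] = []
  insF l (t ∷ ts) = map (_∷ ts) (insT l t) ++ map (t ∷_) (insF l ts)

ins : ℕ → List Tree → List (List Tree)
ins l F = insF l F ++ ((F ++ leaf l ∷ []) ∷ [])

forests : ℕ → List (List Tree)
forests zero = [] ∷ []
forests (suc n) = concatMap (ins (suc n)) (forests n)

length-insLeaf : ∀ x ts → All (λ G → length G ≡ suc (length ts)) (insLeaf x ts)
length-insLeaf x [] = refl ∷ []
length-insLeaf x (t ∷ ts) = refl ∷ AllP.map⁺ (All.map (cong suc) (length-insLeaf x ts))

length-insF : ∀ l F → All (λ G → length G ≡ length F) (insF l F)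
length-insF l [] = []
length-insF l (t ∷ ts) = AllP.++⁺ (AllP.map⁺ (All.tabulate (λ _ → refl))) (AllP.map⁺ (All.map (cong suc) (length-insF l ts)))

-- The operator Δ_k = D_r + k e₁.  On a forest weight w(F)·y^k, the operator
-- D̃_r acts as Δ_k on w(F).

Δ : ∀ {r} → ℕ → Poly r → Poly r
Δ k p = Dr p +P (k ⊙ (e₁ *P p))

⊙-+ℕ : ∀ {r} j k (p : Poly r) → ((j + k) ⊙ p) ≋ ((j ⊙ p) +P (k ⊙ p))
⊙-+ℕ zero k p = ≋-refl
⊙-+ℕ (suc j) k p = ≋-trans (+P-congʳ p (⊙-+ℕ j k p)) (≋-sym (+P-assoc p (j ⊙ p) (k ⊙ p)))

Δ-product : ∀ {r} j k (P Q : Poly r) → Δ (j + k) (P *P Q) ≋ ((Δ j P *P Q) +P (P *P Δ k Q))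
Δ-product {r} j k P Q =
  (Dr (P *P Q) +P ((j + k) ⊙ (e₁ *P (P *P Q))))
    ≋⟨ +P-cong (Dr-leibniz P Q) (⊙-+ℕ j k (e₁ *P (P *P Q))) ⟩
  (((Dr P *P Q) +P (P *P Dr Q)) +P (byJ +P byK))
    ≋⟨ regroup (Dr P *P Q) (P *P Dr Q) byJ byK ⟩
  (((Dr P *P Q) +P byJ) +P ((P *P Dr Q) +P byK))
    ≋⟨ +P-cong (+P-congʳ (Dr P *P Q) (≋-sym (≋-trans (⊙-*ˡ j (e₁ *P P) Q) (⊙-cong j (*P-assoc e₁ P Q)))))
               (+P-congʳ (P *P Dr Q) (≋-sym (≋-trans (⊙-*ʳ k P (e₁ *P Q)) (⊙-cong k (swap P e₁ Q))))) ⟩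
  (((Dr P *P Q) +P ((j ⊙ (e₁ *P P)) *P Q)) +P ((P *P Dr Q) +P (P *P (k ⊙ (e₁ *P Q)))))
    ≋⟨ ≋-sym (+P-cong (*P-distribʳ (Dr P) _ Q) (*P-distribˡ P (Dr Q) _)) ⟩
  ((Δ j P *P Q) +P (P *P Δ k Q)) ∎P
  where
  byJ byK : Poly r
  byJ = j ⊙ (e₁ *P (P *P Q))
  byK = k ⊙ (e₁ *P (P *P Q))
  open import Algebra.Solver.Ring.NaturalCoefficients.Default (PolySemiring r)
  regroup : (a b c d : Poly r) → ((a +P b) +P (c +P d)) ≋ ((a +P c) +P (b +P d))
  regroup = solve 4 (λ a b c d → (a :+ b) :+ (c :+ d) := (a :+ c) :+ (b :+ d)) ≋-refl
  swap : (a b c : Poly r) → (a *P (b *P c)) ≋ (b *P (a *P c))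
  swap = solve 3 (λ a b c → a :* (b :* c) := b :* (a :* c)) ≋-refl

Δ-esym : ∀ r d → Δ 1 (esym r d) ≋ ((d ⊙ (e₁ *P esym r d)) +P (suc d ⊙ esym r (suc d)))
Δ-esym r d = ≋-trans (+P-congʳ (Dr (esym r d)) (+P-identityʳ (e₁ *P esym r d))) (esym-identity r d)

Δ-node : ∀ r d (W : Poly r) → Δ 1 (esym r d *P W) ≋ (((suc d ⊙ esym r (suc d)) *P W) +P (esym r d *P Δ d W))
Δ-node r d W =
  Δ 1 (E *P W)
    ≋⟨ Δ-product 1 0 E W ⟩
  ((Δ 1 E *P W) +P (E *P Δ 0 W))
    ≋⟨ +P-congˡ (E *P Δ 0 W) (≋-trans (*P-congˡ W (Δ-esym r d)) (*P-distribʳ (d ⊙ (e₁ *P E)) E′ W)) ⟩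
  ((((d ⊙ (e₁ *P E)) *P W) +P (E′ *P W)) +P (E *P Δ 0 W))
    ≋⟨ +P-cong (+P-congˡ (E′ *P W) moveE) (*P-congʳ E (+P-identityʳ (Dr W))) ⟩
  (((E *P (d ⊙ (e₁ *P W))) +P (E′ *P W)) +P (E *P Dr W))
    ≋⟨ regroup (d ⊙ (e₁ *P W)) (E′ *P W) E (Dr W) ⟩
  ((E′ *P W) +P (E *P Δ d W)) ∎P
  where
  E E′ : Poly r
  E = esym r d
  E′ = suc d ⊙ esym r (suc d)
  open import Algebra.Solver.Ring.NaturalCoefficients.Default (PolySemiring r)
  moveE : ((d ⊙ (e₁ *P E)) *P W) ≋ (E *P (d ⊙ (e₁ *P W)))
  moveE = ≋-trans (⊙-*ˡ d (e₁ *P E) W) (≋-trans (⊙-cong d (solve 3 (λ a b c → (a :* b) :* c := b :* (a :* c)) ≋-refl e₁ E W))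
                                                 (≋-sym (⊙-*ʳ d E (e₁ *P W))))
  regroup : (a b e w : Poly r) → (((e *P a) +P b) +P (e *P w)) ≋ (b +P (e *P (w +P a)))
  regroup = solve 4 (λ a b e w → ((e :* a) :+ b) :+ (e :* w) := b :+ (e :* (w :+ a))) ≋-refl

insLeaf-weight : ∀ r x ts → wT (esym r) x ≋ oneP →
  sumP (map (wF (esym r)) (insLeaf x ts)) ≋ (suc (length ts) ⊙ wF (esym r) ts)
insLeaf-weight r x [] wx≋1 = +P-congˡ zeroP (≋-trans (*P-identityʳ (wT (esym r) x)) wx≋1)
insLeaf-weight r x (t ∷ ts) wx≋1 =
  (wF e (x ∷ t ∷ ts) +P sumP (map (wF e) (map (t ∷_) (insLeaf x ts))))
    ≋⟨ +P-cong (≋-trans (*P-congˡ (wF e (t ∷ ts)) wx≋1) (*P-identityˡ (wF e (t ∷ ts)))) (Σ-map (wF e) (t ∷_) (insLeaf x ts)) ⟩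
  (wF e (t ∷ ts) +P sumP (map (λ G → wT e t *P wF e G) (insLeaf x ts)))
    ≋⟨ +P-congʳ (wF e (t ∷ ts)) (≋-trans (≋-sym (Σ-*ˡ (wT e t) (wF e) (insLeaf x ts)))
          (≋-trans (*P-congʳ (wT e t) (insLeaf-weight r x ts wx≋1)) (⊙-*ʳ (suc (length ts)) (wT e t) (wF e ts)))) ⟩
  (wF e (t ∷ ts) +P (suc (length ts) ⊙ wF e (t ∷ ts))) ∎P
  where
  e = esym r

leaf-weight : ∀ r l → wT (esym r) (leaf l) ≋ oneP
leaf-weight r l = ≋-trans (*P-identityʳ (esym r 0)) (esym-zero r)

mutual
  insT-weight : ∀ r l t → Δ 1 (wT (esym r) t) ≋ sumP (map (wT (esym r)) (insT l t))
  insT-weight r l (node a ts) =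
    Δ 1 (e d *P W)
      ≋⟨ Δ-node r d W ⟩
    (((suc d ⊙ e (suc d)) *P W) +P (e d *P Δ d W))
      ≋⟨ +P-cong atVertex belowChildren ⟩
    (sumP (map (wT e ∘ node a) (insLeaf (leaf l) ts)) +P sumP (map (wT e ∘ node a) (insF l ts)))
      ≋⟨ ≋-sym (Σ-++ (wT e ∘ node a) (insLeaf (leaf l) ts) (insF l ts)) ⟩
    sumP (map (wT e ∘ node a) (insLeaf (leaf l) ts ++ insF l ts))
      ≋⟨ ≋-sym (Σ-map (wT e) (node a) (insLeaf (leaf l) ts ++ insF l ts)) ⟩
    sumP (map (wT e) (insT l (node a ts))) ∎P
    where
    e = esym r
    d = length ts
    W = wF e ts
    -- the new leaf becomes a child of the root: e_d turns into e_{d+1}, in d+1 ways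
    atVertex : ((suc d ⊙ e (suc d)) *P W) ≋ sumP (map (wT e ∘ node a) (insLeaf (leaf l) ts))
    atVertex = ≋-sym (
      sumP (map (wT e ∘ node a) (insLeaf (leaf l) ts))
        ≋⟨ Σ-cong-All (length-insLeaf (leaf l) ts) (λ G |G| → ≡⇒≋ (cong (λ k → e k *P wF e G) |G|)) ⟩
      sumP (map (λ G → e (suc d) *P wF e G) (insLeaf (leaf l) ts))
        ≋⟨ ≋-sym (Σ-*ˡ (e (suc d)) (wF e) (insLeaf (leaf l) ts)) ⟩
      (e (suc d) *P sumP (map (wF e) (insLeaf (leaf l) ts)))
        ≋⟨ *P-congʳ (e (suc d)) (insLeaf-weight r (leaf l) ts (leaf-weight r l)) ⟩
      (e (suc d) *P (suc d ⊙ W))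
        ≋⟨ ≋-trans (⊙-*ʳ (suc d) (e (suc d)) W) (≋-sym (⊙-*ˡ (suc d) (e (suc d)) W)) ⟩
      ((suc d ⊙ e (suc d)) *P W) ∎P)
    -- the new leaf goes deeper: the root keeps its d children
    belowChildren : (e d *P Δ d W) ≋ sumP (map (wT e ∘ node a) (insF l ts))
    belowChildren = ≋-sym (
      sumP (map (wT e ∘ node a) (insF l ts))
        ≋⟨ Σ-cong-All (length-insF l ts) (λ G |G| → ≡⇒≋ (cong (λ k → e k *P wF e G) |G|)) ⟩
      sumP (map (λ G → e d *P wF e G) (insF l ts))
        ≋⟨ ≋-sym (Σ-*ˡ (e d) (wF e) (insF l ts)) ⟩
      (e d *P sumP (map (wF e) (insF l ts)))
        ≋⟨ *P-congʳ (e d) (≋-sym (insF-weight r l ts)) ⟩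
      (e d *P Δ d W) ∎P)

  insF-weight : ∀ r l F → Δ (length F) (wF (esym r) F) ≋ sumP (map (wF (esym r)) (insF l F))
  insF-weight r l [] = ≋-trans (+P-identityʳ (Dr oneP)) (Dr-yPow 0)
  insF-weight r l (t ∷ ts) =
    Δ (1 + length ts) (wT e t *P wF e ts)
      ≋⟨ Δ-product 1 (length ts) (wT e t) (wF e ts) ⟩
    ((Δ 1 (wT e t) *P wF e ts) +P (wT e t *P Δ (length ts) (wF e ts)))
      ≋⟨ +P-cong (≋-trans (*P-congˡ (wF e ts) (insT-weight r l t)) (Σ-*ʳ (wT e) (insT l t) (wF e ts)))
                 (≋-trans (*P-congʳ (wT e t) (insF-weight r l ts)) (Σ-*ˡ (wT e t) (wF e) (insF l ts))) ⟩
    (sumP (map (λ t′ → wT e t′ *P wF e ts) (insT l t)) +P sumP (map (λ G → wT e t *P wF e G) (insF l ts)))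
      ≋⟨ ≋-sym (+P-cong (Σ-map (wF e) (_∷ ts) (insT l t)) (Σ-map (wF e) (t ∷_) (insF l ts))) ⟩
    (sumP (map (wF e) (map (_∷ ts) (insT l t))) +P sumP (map (wF e) (map (t ∷_) (insF l ts))))
      ≋⟨ ≋-sym (Σ-++ (wF e) (map (_∷ ts) (insT l t)) (map (t ∷_) (insF l ts))) ⟩
    sumP (map (wF e) (insF l (t ∷ ts))) ∎P
    where
    e = esym r

y-yPow : ∀ {r} k → (yVar {r} *P yPow k) ≋ yPow (suc k)
y-yPow {r} k = single-≡ refl (cong (_, suc k) (vadd-identityˡ (replicate r 0)))

y∂y-yPow : ∀ {r} k → (yVar {r} *P ∂y (yPow k)) ≋ (k ⊙ yPow k)
y∂y-yPow {r} zero = single-zero _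
y∂y-yPow {r} (suc k) = mk λ m → begin
  coeff (yVar *P ∂y (yPow (suc k))) m
    ≡⟨ un (single-≡ (trans (*-identityˡ _) (*-identityˡ _)) (cong (_, suc k) (vadd-identityˡ (replicate r 0)))) m ⟩
  termCoeff (suc k , yMon) m + 0                ≡⟨ +-identityʳ _ ⟩
  iverson (yMon ≟M m) (suc k)                   ≡⟨ cong (iverson (yMon ≟M m)) (sym (*-identityʳ (suc k))) ⟩
  iverson (yMon ≟M m) (suc k * 1)               ≡⟨ sym (iverson-*ʳ (yMon ≟M m) (suc k) 1) ⟩
  suc k * termCoeff (1 , yMon) m                ≡⟨ cong (suc k *_) (sym (+-identityʳ _)) ⟩
  suc k * coeff (yPow (suc k)) m                ≡⟨ sym (coeff-⊙ (suc k) (yPow (suc k)) m) ⟩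
  coeff (suc k ⊙ yPow (suc k)) m ∎
  where
  open ≡-Reasoning
  yMon : Mon r
  yMon = (replicate r 0 , suc k)

step-yFree : ∀ {r} {W : Poly r} k → YFree W → step (W *P yPow k) ≋ ((Δ k W *P yPow k) +P (W *P yPow (suc k)))
step-yFree {r} {W} k free =
  ((Dr (W *P Y) +P ((e₁ *P yVar) *P ∂y (W *P Y))) +P (yVar *P (W *P Y)))
    ≋⟨ +P-cong (+P-cong DrWY yDerivative) multiplyY ⟩
  (((Dr W *P Y) +P ((k ⊙ (e₁ *P W)) *P Y)) +P (W *P yPow (suc k)))
    ≋⟨ +P-congˡ (W *P yPow (suc k)) (≋-sym (*P-distribʳ (Dr W) (k ⊙ (e₁ *P W)) Y)) ⟩
  ((Δ k W *P Y) +P (W *P yPow (suc k))) ∎P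
  where
  Y = yPow {r} k
  open import Algebra.Solver.Ring.NaturalCoefficients.Default (PolySemiring r)
  -- D_r only sees W
  DrWY : Dr (W *P Y) ≋ (Dr W *P Y)
  DrWY = ≋-trans (Dr-leibniz W Y)
    (≋-trans (+P-congʳ (Dr W *P Y) (≋-trans (*P-congʳ W (Dr-yPow k)) (*P-zeroʳ W))) (+P-identityʳ (Dr W *P Y)))
  -- e₁ y ∂/∂y only sees y^k, and y ∂y^k/∂y = k y^k
  yDerivative : ((e₁ *P yVar) *P ∂y (W *P Y)) ≋ ((k ⊙ (e₁ *P W)) *P Y)
  yDerivative =
    ((e₁ *P yVar) *P ∂y (W *P Y))
      ≋⟨ *P-congʳ (e₁ *P yVar) (≋-trans (∂y.∂-leibniz W Y)
           (≋-trans (+P-congˡ (W *P ∂y Y) (≋-trans (*P-congˡ Y (∂y-YFree free)) (*P-zeroˡ Y))) (+P-identityˡ (W *P ∂y Y)))) ⟩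
    ((e₁ *P yVar) *P (W *P ∂y Y))
      ≋⟨ solve 4 (λ e y w d → (e :* y) :* (w :* d) := (e :* w) :* (y :* d)) ≋-refl e₁ yVar W (∂y Y) ⟩
    ((e₁ *P W) *P (yVar *P ∂y Y))
      ≋⟨ ≋-trans (*P-congʳ (e₁ *P W) (y∂y-yPow k)) (≋-trans (⊙-*ʳ k (e₁ *P W) Y) (≋-sym (⊙-*ˡ k (e₁ *P W) Y))) ⟩
    ((k ⊙ (e₁ *P W)) *P Y) ∎P
  multiplyY : (yVar *P (W *P Y)) ≋ (W *P yPow (suc k))
  multiplyY = ≋-trans (solve 3 (λ y w z → y :* (w :* z) := w :* (y :* z)) ≋-refl yVar W Y) (*P-congʳ W (y-yPow k))

step-cong : ∀ {r} {p q : Poly r} → p ≋ q → step p ≋ step q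
step-cong {r} e = +P-cong (+P-cong (Dr-cong e) (*P-congʳ (e₁ *P yVar) (∂y.∂-cong e))) (*P-congʳ yVar e)

step-+ : ∀ {r} (p q : Poly r) → step (p +P q) ≋ (step p +P step q)
step-+ {r} p q =
  ≋-trans (+P-cong (+P-cong (Dr-+ p q) (≋-trans (*P-congʳ (e₁ *P yVar) (∂y.∂-+ p q)) (*P-distribˡ (e₁ *P yVar) (∂y p) (∂y q))))
                   (*P-distribˡ yVar p q))
          (regroup (Dr p) (Dr q) ((e₁ *P yVar) *P ∂y p) ((e₁ *P yVar) *P ∂y q) (yVar *P p) (yVar *P q))
  where
  open import Algebra.Solver.Ring.NaturalCoefficients.Default (PolySemiring r)
  regroup : (a b c d x y : Poly r) → (((a +P b) +P (c +P d)) +P (x +P y)) ≋ (((a +P c) +P x) +P ((b +P d) +P y))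
  regroup = solve 6 (λ a b c d x y → ((a :+ b) :+ (c :+ d)) :+ (x :+ y) := ((a :+ c) :+ x) :+ ((b :+ d) :+ y)) ≋-refl

step-Σ : ∀ {r} (f : A → Poly r) (xs : List A) → step (sumP (map f xs)) ≋ sumP (map (λ x → step (f x)) xs)
step-Σ {r} f [] = +P-cong (+P-cong Dr-zero (*P-zeroʳ (e₁ *P yVar))) (*P-zeroʳ yVar)
step-Σ f (x ∷ xs) = ≋-trans (step-+ (f x) _) (+P-congʳ (step (f x)) (step-Σ f xs))

mutual
  YFree-wT : ∀ r t → YFree (wT (esym r) t)
  YFree-wT r (node a ts) = YFree-* (YFree-esym (length ts)) (YFree-wF r ts)
    where
    YFree-esym : ∀ d → YFree (esym r d)
    YFree-esym d = AllP.map⁺ {xs = filter (λ S → card S ≟ d) (allSubsets r)} (All.tabulate (λ _ → refl))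

  YFree-wF : ∀ r F → YFree (wF (esym r) F)
  YFree-wF r [] = refl ∷ []
  YFree-wF r (t ∷ ts) = YFree-* (YFree-wT r t) (YFree-wF r ts)

wF-++ : ∀ r F G → wF (esym r) (F ++ G) ≋ (wF (esym r) F *P wF (esym r) G)
wF-++ r [] G = ≋-sym (*P-identityˡ (wF (esym r) G))
wF-++ r (t ∷ F) G = ≋-trans (*P-congʳ (wT (esym r) t) (wF-++ r F G)) (≋-sym (*P-assoc (wT (esym r) t) _ _))

ins-weight : ∀ r l F → sumP (map (forestWeight (esym r)) (ins l F)) ≋ step (forestWeight (esym r) F)
ins-weight r l F =
  sumP (map FW (ins l F))
    ≋⟨ Σ-++ FW (insF l F) ((F ++ leaf l ∷ []) ∷ []) ⟩
  (sumP (map FW (insF l F)) +P (FW (F ++ leaf l ∷ []) +P zeroP))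
    ≋⟨ +P-cong belowVertex (≋-trans (+P-identityʳ _) newTree) ⟩
  ((Δ k W *P yPow k) +P (W *P yPow (suc k)))
    ≋⟨ ≋-sym (step-yFree k (YFree-wF r F)) ⟩
  step (FW F) ∎P
  where
  FW = forestWeight (esym r)
  W = wF (esym r) F
  k = length F
  belowVertex : sumP (map FW (insF l F)) ≋ (Δ k W *P yPow k)
  belowVertex =
    ≋-trans (Σ-cong-All (length-insF l F) (λ G |G| → ≡⇒≋ (cong (λ j → wF (esym r) G *P yPow j) |G|)))
    (≋-trans (≋-sym (Σ-*ʳ (wF (esym r)) (insF l F) (yPow k))) (*P-congˡ (yPow k) (≋-sym (insF-weight r l F))))
  newTree : FW (F ++ leaf l ∷ []) ≋ (W *P yPow (suc k))
  newTree =
    ≋-trans (*P-congˡ (yPow (length (F ++ leaf l ∷ [])))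
              (≋-trans (wF-++ r F (leaf l ∷ [])) (≋-trans (*P-congʳ W (≋-trans (*P-identityʳ _) (leaf-weight r l))) (*P-identityʳ W))))
            (≡⇒≋ (cong (λ j → W *P yPow j) (trans (LP.length-++ F) (+-comm k 1))))

lahSum-forests : ∀ r n → lahSum (esym r) (forests n) ≋ rhs r n
lahSum-forests r zero = ≋-trans (+P-identityʳ _) (*P-identityʳ oneP)
lahSum-forests r (suc n) =
  lahSum (esym r) (forests (suc n))
    ≋⟨ Σ-concatMap (forestWeight (esym r)) (ins (suc n)) (forests n) ⟩
  sumP (map (λ F → sumP (map (forestWeight (esym r)) (ins (suc n) F))) (forests n))
    ≋⟨ Σ-cong (forests n) (ins-weight r (suc n)) ⟩
  sumP (map (λ F → step (forestWeight (esym r) F)) (forests n))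
    ≋⟨ ≋-sym (step-Σ (forestWeight (esym r)) (forests n)) ⟩
  step (lahSum (esym r) (forests n))
    ≋⟨ step-cong (lahSum-forests r n) ⟩
  rhs r (suc n) ∎P

roots : List Tree → List ℕ
roots = map rootLabel

roots-++ : ∀ F G → roots (F ++ G) ≡ roots F ++ roots G
roots-++ F G = LP.map-++ rootLabel F G

labelsF-++ : ∀ F G → labelsF (F ++ G) ≡ labelsF F ++ labelsF G
labelsF-++ [] G = refl
labelsF-++ (t ∷ F) G = trans (cong (labelsT t ++_) (labelsF-++ F G)) (sym (LP.++-assoc (labelsT t) (labelsF F) (labelsF G)))

IncF→All : ∀ F → IncF F → All IncT F
IncF→All [] _ = []
IncF→All (t ∷ F) (inc , incs) = inc ∷ IncF→All F incs

All→IncF : ∀ {F} → All IncT F → IncF F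
All→IncF [] = tt
All→IncF (inc ∷ incs) = inc , All→IncF incs

Below : ℕ → List Tree → Set
Below l F = All (_< l) (labelsF F)

Increasing : List Tree → Set
Increasing G = All IncT G × Linked _<_ (roots G)

insChildren : ℕ → List Tree → List (List Tree)
insChildren l ts = insLeaf (leaf l) ts ++ insF l ts

module Insertion (l : ℕ) where

  labels-insLeaf : ∀ ts → All (λ G → labelsF G ↭ l ∷ labelsF ts) (insLeaf (leaf l) ts)
  labels-insLeaf [] = ↭-refl ∷ []
  labels-insLeaf (t ∷ ts) =
    ↭-refl ∷ AllP.map⁺ (All.map (λ p → ↭-trans (PermP.++⁺ˡ (labelsT t) p) (PermP.shift l (labelsT t) (labelsF ts)))
                                (labels-insLeaf ts))

  mutual
    labels-insT : ∀ t → All (λ t′ → labelsT t′ ↭ l ∷ labelsT t) (insT l t)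
    labels-insT (node a ts) = AllP.map⁺ (AllP.++⁺
      (All.map (λ p → ↭-trans (↭-prep a p) (↭-swap a l ↭-refl)) (labels-insLeaf ts))
      (All.map (λ p → ↭-trans (↭-prep a p) (↭-swap a l ↭-refl)) (labels-insF ts)))

    labels-insF : ∀ F → All (λ G → labelsF G ↭ l ∷ labelsF F) (insF l F)
    labels-insF [] = []
    labels-insF (t ∷ ts) = AllP.++⁺
      (AllP.map⁺ (All.map (PermP.++⁺ʳ (labelsF ts)) (labels-insT t)))
      (AllP.map⁺ (All.map (λ p → ↭-trans (PermP.++⁺ˡ (labelsT t) p) (PermP.shift l (labelsT t) (labelsF ts))) (labels-insF ts)))

  labels-ins : ∀ F → All (λ G → labelsF G ↭ l ∷ labelsF F) (ins l F)
  labels-ins F = AllP.++⁺ (labels-insF F) (labels-snoc ∷ [])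
    where
    labels-snoc : labelsF (F ++ leaf l ∷ []) ↭ l ∷ labelsF F
    labels-snoc rewrite labelsF-++ F (leaf l ∷ []) = PermP.++-comm (labelsF F) (l ∷ [])

  root-insT : ∀ t → All (λ t′ → rootLabel t′ ≡ rootLabel t) (insT l t)
  root-insT (node a ts) = AllP.map⁺ (All.tabulate (λ _ → refl))

  roots-insF : ∀ F → All (λ G → roots G ≡ roots F) (insF l F)
  roots-insF [] = []
  roots-insF (t ∷ ts) = AllP.++⁺ (AllP.map⁺ (All.map (cong (_∷ roots ts)) (root-insT t)))
                                 (AllP.map⁺ (All.map (cong (rootLabel t ∷_)) (roots-insF ts)))

  leaf-inc : IncT (leaf l)
  leaf-inc = [] , tt

  inc-insLeaf : ∀ a ts → a < l → All IncT ts → All (λ c → a < rootLabel c) ts →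
    All (λ G → All IncT G × All (λ c → a < rootLabel c) G) (insLeaf (leaf l) ts)
  inc-insLeaf a [] a<l [] [] = ((leaf-inc ∷ []) , (a<l ∷ [])) ∷ []
  inc-insLeaf a (t ∷ ts) a<l (inc ∷ incs) (a<t ∷ a<ts) =
    ((leaf-inc ∷ inc ∷ incs) , (a<l ∷ a<t ∷ a<ts)) ∷
    AllP.map⁺ (All.map (λ { (x , y) → (inc ∷ x) , (a<t ∷ y) }) (inc-insLeaf a ts a<l incs a<ts))

  mutual
    inc-insT : ∀ t → IncT t → All (_< l) (labelsT t) → All IncT (insT l t)
    inc-insT (node a ts) (a<ts , incs) (a<l ∷ below) = AllP.map⁺ (AllP.++⁺
      (All.map (λ { (x , y) → y , All→IncF x }) (inc-insLeaf a ts a<l (IncF→All ts incs) a<ts))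
      (All.zipWith (λ { (x , e) → AllP.map⁻ (subst (All (a <_)) (sym e) (AllP.map⁺ a<ts)) , All→IncF x })
                   (inc-insF ts (IncF→All ts incs) below , roots-insF ts)))

    inc-insF : ∀ F → All IncT F → Below l F → All (All IncT) (insF l F)
    inc-insF [] _ _ = []
    inc-insF (t ∷ ts) (inc ∷ incs) below with AllP.++⁻ (labelsT t) below
    ... | below-t , below-ts = AllP.++⁺
      (AllP.map⁺ (All.map (_∷ incs) (inc-insT t inc below-t)))
      (AllP.map⁺ (All.map (inc ∷_) (inc-insF ts incs below-ts)))

  roots⊆labels : ∀ {P : ℕ → Set} F → All P (labelsF F) → All P (roots F)
  roots⊆labels [] _ = []
  roots⊆labels (node a cs ∷ ts) (pa ∷ ps) = pa ∷ roots⊆labels ts (proj₂ (AllP.++⁻ (labelsF cs) ps))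

  linked-snoc : ∀ xs → Linked _<_ xs → All (_< l) xs → Linked _<_ (xs ++ l ∷ [])
  linked-snoc [] _ _ = [-]
  linked-snoc (x ∷ []) _ (x<l ∷ []) = x<l ∷ [-]
  linked-snoc (x ∷ y ∷ xs) (x<y ∷ lk) (_ ∷ a) = x<y ∷ linked-snoc (y ∷ xs) lk a

  sound-ins : ∀ F → Increasing F → Below l F → All Increasing (ins l F)
  sound-ins F (inc , sorted) below = AllP.++⁺
    (All.zipWith (λ { (x , e) → x , subst (Linked _<_) (sym e) sorted }) (inc-insF F inc below , roots-insF F))
    ((AllP.++⁺ inc (leaf-inc ∷ []) ,
      subst (Linked _<_) (sym (roots-++ F (leaf l ∷ []))) (linked-snoc (roots F) sorted (roots⊆labels F below))) ∷ [])

  reflect-insLeaf : ∀ {Q : Tree → Set} x ts → All (λ G → All Q G → All Q ts) (insLeaf x ts)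
  reflect-insLeaf x [] = (λ _ → []) ∷ []
  reflect-insLeaf x (t ∷ ts) =
    (λ { (_ ∷ a) → a }) ∷ AllP.map⁺ (All.map (λ f → λ { (q ∷ a) → q ∷ f a }) (reflect-insLeaf x ts))

  mutual
    reflect-insT : ∀ t → All (λ t′ → IncT t′ → IncT t) (insT l t)
    reflect-insT (node a ts) = AllP.map⁺ (AllP.++⁺
      (All.zipWith (λ { (f , g) → λ { (a<G , incG) → f a<G , All→IncF (g (IncF→All _ incG)) } })
                   (reflect-insLeaf (leaf l) ts , reflect-insLeaf (leaf l) ts))
      (All.zipWith (λ { (f , e) → λ { (a<G , incG) →
                      AllP.map⁻ (subst (All (a <_)) e (AllP.map⁺ a<G)) , All→IncF (f (IncF→All _ incG)) } })
                   (reflect-insF ts , roots-insF ts)))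

    reflect-insF : ∀ F → All (λ G → All IncT G → All IncT F) (insF l F)
    reflect-insF [] = []
    reflect-insF (t ∷ ts) = AllP.++⁺
      (AllP.map⁺ (All.map (λ f → λ { (i ∷ is) → f i ∷ is }) (reflect-insT t)))
      (AllP.map⁺ (All.map (λ f → λ { (i ∷ is) → i ∷ f is }) (reflect-insF ts)))

  linked-unsnoc : ∀ xs {y} → Linked _<_ (xs ++ y ∷ []) → Linked _<_ xs
  linked-unsnoc [] _ = []
  linked-unsnoc (x ∷ []) _ = [-]
  linked-unsnoc (x ∷ x′ ∷ xs) (x<x′ ∷ lk) = x<x′ ∷ linked-unsnoc (x′ ∷ xs) lk

  reflect-ins : ∀ F → All (λ G → Increasing G → Increasing F) (ins l F)
  reflect-ins F = AllP.++⁺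
    (All.zipWith (λ { (f , e) → λ { (inc , sorted) → f inc , subst (Linked _<_) e sorted } }) (reflect-insF F , roots-insF F))
    ((λ { (inc , sorted) → AllP.++⁻ˡ F inc ,
                           linked-unsnoc (roots F) (subst (Linked _<_) (roots-++ F (leaf l ∷ [])) sorted) }) ∷ [])

  maximal-leaf : ∀ cs → IncT (node l cs) → All (_≤ l) (labelsT (node l cs)) → cs ≡ []
  maximal-leaf [] _ _ = refl
  maximal-leaf (node d ds ∷ cs) ((l<d ∷ _) , _) (_ ∷ d≤l ∷ _) = ⊥-elim (<⇒≱ l<d d≤l)

  insLeaf-front : ∀ x ts → (x ∷ ts) ∈ insLeaf x ts
  insLeaf-front x [] = here refl
  insLeaf-front x (t ∷ ts) = here refl

  insChildren-cons : ∀ t ts → (∃ λ F → ts ∈ insChildren l F) → ∃ λ F → (t ∷ ts) ∈ insChildren l F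
  insChildren-cons t ts (F , p) with ∈-++⁻ (insLeaf (leaf l) F) p
  ... | inj₁ p₁ = (t ∷ F) , ∈-++⁺ˡ (there (∈-map⁺ (t ∷_) p₁))
  ... | inj₂ p₂ = (t ∷ F) , ∈-++⁺ʳ (insLeaf (leaf l) (t ∷ F)) (∈-++⁺ʳ (map (_∷ F) (insT l t)) (∈-map⁺ (t ∷_) p₂))

  children-from : ∀ G → All IncT G → All (_≤ l) (labelsF G) → l ∈ labelsF G → ∃ λ F → G ∈ insChildren l F
  children-from [] _ _ ()
  children-from (node b cs ∷ ts) (inc ∷ incs) le l∈ with ∈-++⁻ (labelsT (node b cs)) l∈
  ... | inj₂ l∈ts = insChildren-cons (node b cs) ts (children-from ts incs (AllP.++⁻ʳ (labelsT (node b cs)) le) l∈ts)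
  ... | inj₁ (here refl) with maximal-leaf cs inc (AllP.++⁻ˡ (labelsT (node l cs)) le)
  ...   | refl = ts , ∈-++⁺ˡ (insLeaf-front (leaf l) ts)
  children-from (node b cs ∷ ts) (inc ∷ incs) (_ ∷ le) l∈ | inj₁ (there l∈cs)
    with children-from cs (IncF→All cs (proj₂ inc)) (AllP.++⁻ˡ (labelsF cs) le) l∈cs
  ... | F , p = (node b F ∷ ts) , ∈-++⁺ʳ (insLeaf (leaf l) (node b F ∷ ts)) (∈-++⁺ˡ (∈-map⁺ (_∷ ts) (∈-map⁺ (node b) p)))

  tree-from : ∀ t → IncT t → All (_≤ l) (labelsT t) → l ∈ labelsT t → rootLabel t ≢ l → ∃ λ t′ → t ∈ insT l t′
  tree-from (node a ts) _ _ (here a≡l) a≢l = ⊥-elim (a≢l (sym a≡l))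
  tree-from (node a ts) (_ , incs) (_ ∷ le) (there l∈) _ with children-from ts (IncF→All ts incs) le l∈
  ... | F , p = node a F , ∈-map⁺ (node a) p

  forest-from : ∀ G → Increasing G → All (_≤ l) (labelsF G) → l ∈ labelsF G → ∃ λ F → G ∈ ins l F
  forest-from [] _ _ ()
  forest-from (node b cs ∷ ts) (inc ∷ incs , sorted) le l∈ with ∈-++⁻ (labelsT (node b cs)) l∈
  ... | inj₂ l∈ts with forest-from ts (incs , Linked.tail sorted) (AllP.++⁻ʳ (labelsT (node b cs)) le) l∈ts
  ...   | F , p with ∈-++⁻ (insF l F) p
  ...     | inj₁ p₁ = (node b cs ∷ F) , ∈-++⁺ˡ (∈-++⁺ʳ (map (_∷ F) (insT l (node b cs))) (∈-map⁺ (node b cs ∷_) p₁))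
  ...     | inj₂ (here e) = (node b cs ∷ F) , ∈-++⁺ʳ (insF l (node b cs ∷ F)) (here (cong (node b cs ∷_) e))
  forest-from (node b cs ∷ ts) (inc ∷ incs , sorted) le l∈ | inj₁ l∈t with b ≟ l
  ... | yes refl with maximal-leaf cs inc (AllP.++⁻ˡ (labelsT (node b cs)) le)
  ...   | refl with ts
  ...     | [] = [] , here refl
  ...     | node d ds ∷ ts′ with sorted | le
  ...       | (l<d ∷ _) | (_ ∷ d≤l ∷ _) = ⊥-elim (<⇒≱ l<d d≤l)
  forest-from (node b cs ∷ ts) (inc ∷ incs , sorted) le l∈ | inj₁ l∈t | no b≢l
    with tree-from (node b cs) inc (AllP.++⁻ˡ (labelsT (node b cs)) le) l∈t b≢l
  ... | t′ , p = (t′ ∷ ts) , ∈-++⁺ˡ (∈-++⁺ˡ (∈-map⁺ (_∷ ts) p))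

  -- Deleting the vertices labelled l undoes every insertion; hence insertions
  -- into different forests give different forests.

  mutual
    deleteT : Tree → Tree
    deleteT (node a cs) = node a (deleteF cs)

    deleteF : List Tree → List Tree
    deleteF [] = []
    deleteF (node a cs ∷ ts) = if does (a ≟ l) then deleteF ts else (node a (deleteF cs) ∷ deleteF ts)

  deleteF-≢ : ∀ a cs ts → a ≢ l → deleteF (node a cs ∷ ts) ≡ node a (deleteF cs) ∷ deleteF ts
  deleteF-≢ a cs ts a≢l = cong (λ b → if b then deleteF ts else (node a (deleteF cs) ∷ deleteF ts)) (dec-false (a ≟ l) a≢l)

  deleteF-≡ : ∀ cs ts → deleteF (node l cs ∷ ts) ≡ deleteF ts
  deleteF-≡ cs ts = cong (λ b → if b then deleteF ts else (node l (deleteF cs) ∷ deleteF ts)) (dec-true (l ≟ l) refl)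

  ∉-++ : ∀ (xs : List ℕ) {ys} → l ∉ xs ++ ys → l ∉ xs × l ∉ ys
  ∉-++ xs l∉ = (λ m → l∉ (∈-++⁺ˡ m)) , (λ m → l∉ (∈-++⁺ʳ xs m))

  mutual
    deleteT-id : ∀ t → l ∉ labelsT t → deleteT t ≡ t
    deleteT-id (node a cs) l∉ = cong (node a) (deleteF-id cs (λ m → l∉ (there m)))

    deleteF-id : ∀ F → l ∉ labelsF F → deleteF F ≡ F
    deleteF-id [] _ = refl
    deleteF-id (node a cs ∷ ts) l∉ = trans (deleteF-≢ a cs ts (λ e → l∉ (here (sym e))))
      (cong₂ _∷_ (deleteT-id (node a cs) (proj₁ (∉-++ (labelsT (node a cs)) l∉)))
                 (deleteF-id ts (proj₂ (∉-++ (labelsT (node a cs)) l∉))))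

  delete-insLeaf : ∀ ts → l ∉ labelsF ts → All (λ G → deleteF G ≡ ts) (insLeaf (leaf l) ts)
  delete-insLeaf [] _ = deleteF-≡ [] [] ∷ []
  delete-insLeaf (node a cs ∷ ts) l∉ =
    trans (deleteF-≡ [] (node a cs ∷ ts)) (deleteF-id (node a cs ∷ ts) l∉) ∷
    AllP.map⁺ (All.map (λ {G} e → trans (deleteF-≢ a cs G (λ e → l∉ (here (sym e))))
                                         (cong₂ _∷_ (deleteT-id (node a cs) l∉t) e))
                       (delete-insLeaf ts l∉ts))
    where
    l∉t = proj₁ (∉-++ (labelsT (node a cs)) l∉)
    l∉ts = proj₂ (∉-++ (labelsT (node a cs)) l∉)

  mutual
    delete-insT : ∀ t → l ∉ labelsT t → All (λ t′ → deleteT t′ ≡ t) (insT l t)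
    delete-insT (node a ts) l∉ = AllP.map⁺ (AllP.++⁺
      (All.map (cong (node a)) (delete-insLeaf ts (λ m → l∉ (there m))))
      (All.map (cong (node a)) (delete-insF ts (λ m → l∉ (there m)))))

    delete-insF : ∀ F → l ∉ labelsF F → All (λ G → deleteF G ≡ F) (insF l F)
    delete-insF [] _ = []
    delete-insF (node a cs ∷ ts) l∉ = AllP.++⁺
      (AllP.map⁺ (All.zipWith (λ { (e , root) → trans (deleteHead _ root) (cong (_∷ ts) e) })
                              (delete-insT (node a cs) l∉t , root-insT (node a cs))))
      (AllP.map⁺ (All.map (λ {G} e → trans (deleteF-≢ a cs G (λ e → l∉ (here (sym e))))
                                           (cong₂ _∷_ (deleteT-id (node a cs) l∉t) e))
                          (delete-insF ts l∉ts)))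
      where
      l∉t = proj₁ (∉-++ (labelsT (node a cs)) l∉)
      l∉ts = proj₂ (∉-++ (labelsT (node a cs)) l∉)
      deleteHead : ∀ t′ → rootLabel t′ ≡ a → deleteF (t′ ∷ ts) ≡ deleteT t′ ∷ ts
      deleteHead (node b ds) refl =
        trans (deleteF-≢ a ds ts (λ e → l∉ (here (sym e)))) (cong (node a (deleteF ds) ∷_) (deleteF-id ts l∉ts))

  deleteF-++ : ∀ F G → deleteF (F ++ G) ≡ deleteF F ++ deleteF G
  deleteF-++ [] G = refl
  deleteF-++ (node a cs ∷ F) G with does (a ≟ l)
  ... | true = deleteF-++ F G
  ... | false = cong (node a (deleteF cs) ∷_) (deleteF-++ F G)

  delete-ins : ∀ F → l ∉ labelsF F → All (λ G → deleteF G ≡ F) (ins l F)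
  delete-ins F l∉ = AllP.++⁺ (delete-insF F l∉)
    (trans (deleteF-++ F (leaf l ∷ []))
       (trans (cong (deleteF F ++_) (deleteF-≡ [] [])) (trans (LP.++-identityʳ (deleteF F)) (deleteF-id F l∉))) ∷ [])

  l∈insT : ∀ t → All (λ t′ → l ∈ labelsT t′) (insT l t)
  l∈insT t = All.map (λ p → PermP.∈-resp-↭ (↭-sym p) (here refl)) (labels-insT t)

  unique-insLeaf : ∀ ts → l ∉ labelsF ts → Unique (insLeaf (leaf l) ts)
  unique-insLeaf [] _ = [] ∷ []
  unique-insLeaf (t ∷ ts) l∉ =
    AllP.map⁺ (All.tabulate (λ _ eq → l∉ (∈-++⁺ˡ (subst (λ z → l ∈ labelsT z) (LP.∷-injectiveˡ eq) (here refl)))))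
    ∷ UniqueP.map⁺ LP.∷-injectiveʳ (unique-insLeaf ts (λ m → l∉ (∈-++⁺ʳ (labelsT t) m)))

  mutual
    unique-insT : ∀ t → l ∉ labelsT t → Unique (insT l t)
    unique-insT (node a ts) l∉ = UniqueP.map⁺ (λ { refl → refl })
      (UniqueP.++⁺ (unique-insLeaf ts (λ m → l∉ (there m))) (unique-insF ts (λ m → l∉ (there m)))
        (λ { (m₁ , m₂) → 1+n≢n (sym (trans (sym (All.lookup (length-insF l ts) m₂)) (All.lookup (length-insLeaf (leaf l) ts) m₁))) }))

    unique-insF : ∀ F → l ∉ labelsF F → Unique (insF l F)
    unique-insF [] _ = []
    unique-insF (t ∷ ts) l∉ =
      UniqueP.++⁺ (UniqueP.map⁺ LP.∷-injectiveˡ (unique-insT t l∉t)) (UniqueP.map⁺ LP.∷-injectiveʳ (unique-insF ts l∉ts)) disjoint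
      where
      l∉t = proj₁ (∉-++ (labelsT t) l∉)
      l∉ts = proj₂ (∉-++ (labelsT t) l∉)
      -- only the first kind contains l in its first tree
      disjoint : Disjoint (map (_∷ ts) (insT l t)) (map (t ∷_) (insF l ts))
      disjoint (m₁ , m₂) with ∈-map⁻ (_∷ ts) m₁ | ∈-map⁻ (t ∷_) m₂
      ... | t′ , t′∈ , refl | G , _ , eq = l∉t (subst (λ z → l ∈ labelsT z) (LP.∷-injectiveˡ eq) (All.lookup (l∈insT t) t′∈))

  unique-ins : ∀ F → l ∉ labelsF F → Unique (ins l F)
  unique-ins F l∉ = UniqueP.++⁺ (unique-insF F l∉) ([] ∷ [])
    (λ { (m₁ , here refl) → 1+n≢n (sym (trans (sym (All.lookup (length-insF l F) m₁)) (trans (LP.length-++ F) (+-comm (length F) 1)))) })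

  unique-concatMap-ins : ∀ Fs → Unique Fs → All (λ F → l ∉ labelsF F) Fs → Unique (concatMap (ins l) Fs)
  unique-concatMap-ins [] _ _ = []
  unique-concatMap-ins (F ∷ Fs) (F∉Fs ∷ unique) (l∉F ∷ l∉Fs) =
    UniqueP.++⁺ (unique-ins F l∉F) (unique-concatMap-ins Fs unique l∉Fs) disjoint
    where
    disjoint : Disjoint (ins l F) (concatMap (ins l) Fs)
    disjoint (m₁ , m₂) with find (∈-concatMap⁻ (ins l) {xs = Fs} m₂)
    ... | F′ , F′∈ , m = All.lookup F∉Fs F′∈
        (trans (sym (All.lookup (delete-ins F l∉F) m₁)) (All.lookup (delete-ins F′ (All.lookup l∉Fs F′∈)) m))

interval : ℕ → List ℕ
interval n = map suc (upTo n)

interval-suc : ∀ n → interval (suc n) ↭ suc n ∷ interval n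
interval-suc n =
  subst (λ z → map suc z ↭ suc n ∷ interval n) (LP.applyUpTo-∷ʳ (λ x → x) n)
    (subst (_↭ suc n ∷ interval n) (sym (LP.map-++ suc (upTo n) (n ∷ []))) (↭-sym (PermP.∷↭∷ʳ (suc n) (interval n))))

interval-bound : ∀ {n x} → x ∈ interval n → x ≤ n
interval-bound x∈ with ∈-map⁻ suc x∈
... | y , y∈ , refl = ∈-upTo⁻ y∈

sound : ∀ n F → F ∈ forests n → IncForestOn n F
sound zero F (here refl) = tt , [] , ↭-refl
sound (suc n) F F∈ with find (∈-concatMap⁻ (ins (suc n)) {xs = forests n} F∈)
... | F₀ , F₀∈ , F∈ins with sound n F₀ F₀∈
... | inc₀ , sorted₀ , labels₀ = All→IncF (proj₁ increasing) , proj₂ increasing , labels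
  where
  open Insertion (suc n)
  below : Below (suc n) F₀
  below = All.tabulate (λ x∈ → s≤s (interval-bound (PermP.∈-resp-↭ labels₀ x∈)))
  increasing : Increasing F
  increasing = All.lookup (sound-ins F₀ (IncF→All F₀ inc₀ , sorted₀) below) F∈ins
  labels : labelsF F ↭ interval (suc n)
  labels = ↭-trans (All.lookup (labels-ins F₀) F∈ins) (↭-trans (↭-prep (suc n) labels₀) (↭-sym (interval-suc n)))

complete : ∀ n F → IncForestOn n F → F ∈ forests n
complete zero [] _ = here refl
complete zero (node a cs ∷ F) (_ , _ , labels) with PermP.∈-resp-↭ labels (here {xs = labelsF cs ++ labelsF F} refl)
... | ()
complete (suc n) F (inc , sorted , labels) with Insertion.forest-from (suc n) F (IncF→All F inc , sorted) bounded largest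
  where
  bounded = All.tabulate (λ x∈ → interval-bound (PermP.∈-resp-↭ labels x∈))
  largest = PermP.∈-resp-↭ (↭-sym labels) (PermP.∈-resp-↭ (↭-sym (interval-suc n)) (here refl))
... | F₀ , F∈ins =
  ∈-concatMap⁺ (ins (suc n)) {xs = forests n} (lose (complete n F₀ (All→IncF (proj₁ inc₀) , proj₂ inc₀ , labels₀)) F∈ins)
  where
  open Insertion (suc n)
  inc₀ = All.lookup (reflect-ins F₀) F∈ins (IncF→All F inc , sorted)
  labels₀ : labelsF F₀ ↭ interval n
  labels₀ = PermP.drop-∷ (↭-trans (↭-sym (All.lookup (labels-ins F₀) F∈ins)) (↭-trans labels (interval-suc n)))

unique : ∀ n → Unique (forests n)
unique zero = [] ∷ []
unique (suc n) = Insertion.unique-concatMap-ins (suc n) (forests n) (unique n)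
  (All.tabulate (λ F∈ x∈ → <⇒≱ (n<1+n n) (interval-bound (PermP.∈-resp-↭ (proj₂ (proj₂ (sound n _ F∈))) x∈))))

enumeration-↭ : ∀ n (enum : List (List Tree)) → Unique enum →
  (∀ F → (F ∈ enum → IncForestOn n F) × (IncForestOn n F → F ∈ enum)) → enum ↭ forests n
enumeration-↭ n enum unique-enum exact = ∼bag⇒↭ (unique∧set⇒bag unique-enum (unique n)
  (mk⇔ (λ F∈ → complete n _ (proj₁ (exact _) F∈)) (λ F∈ → proj₂ (exact _) (sound n _ F∈))))

lahSum-↭ : ∀ {r} (φ : ℕ → Poly r) {enum enum′} → enum ↭ enum′ → lahSum φ enum ≋ lahSum φ enum′
lahSum-↭ φ {enum} {enum′} p = mk λ m →
  trans (coeff-sumP (forestWeight φ) enum m)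
    (trans (∑-↭ (λ F → coeff (forestWeight φ F) m) p) (sym (coeff-sumP (forestWeight φ) enum′ m)))

proposition4p2 : (r : ℕ) → 1 ≤ r → (n : ℕ) →
    (enum : List (List Tree)) → Unique enum →
    (∀ F → (F ∈ enum → IncForestOn n F) × (IncForestOn n F → F ∈ enum)) →
    lahSum (esym r) enum ≈P rhs r n
proposition4p2 r _ n enum unique-enum exact =
  un (≋-trans (lahSum-↭ (esym r) (enumeration-↭ n enum unique-enum exact)) (lahSum-forests r n))
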